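{- Let $m$ and $n$ be positive integers with $m$ odd, and let $\Gamma=\mathbb Z_m\times\mathbb Z_{2n}$. Let $\Delta$ be the $2mn$-list consisting of one copy of $(0,0)$ together with one copy of each element $\gamma\in\Gamma$ with $\gamma\neq(0,n)$. Then there exists a $\Delta$-permutation $\psi$ of $\Gamma$ which fixes $(0,0)$ and fixes $\left(-\frac{m-1}{2},\ \left\lfloor\frac{n+1}{2}\right\rfloor+\frac{m-1}{2}n\right)$.
   Context: Groups are written additively. A list is a multiset. For a group $\Gamma$ of order $v$ and a $v$-list $\Delta$ of elements of $\Gamma$, a $\Delta$-permutation of $\Gamma$ is a permutation $\varphi$ of $\Gamma$ such that the multiset $[\varphi(a)-a \mid a\in\Gamma]$ equals $\Delta$. -}

module Defs where

import Data.Nat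
open import Data.Nat using (ℕ; zero; suc; _+_; _*_; _∸_; NonZero)
open import Data.Nat.Properties using (m*n≢0)
open import Data.Nat.DivMod using (_%_; m%n<n)
open import Data.Fin using (Fin; toℕ; fromℕ<)
import Data.Fin.Properties as FinP
open import Data.Product using (_×_; _,_)
open import Data.Product.Properties using (≡-dec)
open import Data.List using (List; _∷_; map; filter; allFin; cartesianProduct)
open import Data.List.Relation.Binary.Permutation.Propositional using (_↭_)
open import Function.Bundles using (_↔_; Inverse)
open import Relation.Binary.PropositionalEquality using (_≡_)
open import Relation.Nullary using (¬_; ¬?)
open import Relation.Binary using (DecidableEquality)

ι : (k : ℕ) .{{_ : NonZero k}} → ℕ → Fin k
ι k x = fromℕ< (m%n<n x k)

module Cyclic (k : ℕ) .{{_ : NonZero k}} where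
  add : Fin k → Fin k → Fin k
  add a b = ι k (toℕ a + toℕ b)

  neg : Fin k → Fin k
  neg a = ι k (k ∸ toℕ a)

  sub : Fin k → Fin k → Fin k
  sub a b = add a (neg b)

module Grp (m n : ℕ) .{{_ : NonZero m}} .{{_ : NonZero n}} where
  instance
    nz2n : NonZero (2 * n)
    nz2n = m*n≢0 2 n

  Γ : Set
  Γ = Fin m × Fin (2 * n)

  _≟Γ_ : DecidableEquality Γ
  _≟Γ_ = ≡-dec FinP._≟_ FinP._≟_

  embed : ℕ → ℕ → Γ
  embed a b = ι m a , ι (2 * n) b

  _-Γ_ : Γ → Γ → Γ
  (a₁ , b₁) -Γ (a₂ , b₂) = Cyclic.sub m a₁ a₂ , Cyclic.sub (2 * n) b₁ b₂

  negΓ : Γ → Γ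
  negΓ (a , b) = Cyclic.neg m a , Cyclic.neg (2 * n) b

  elems : List Γ
  elems = cartesianProduct (allFin m) (allFin (2 * n))

  zeroΓ : Γ
  zeroΓ = embed 0 0

  -- Δ-permutation: a permutation φ of Γ whose multiset of differences
  -- [φ(a) - a | a ∈ Γ] equals Δ (multiset equality = list permutation)
  IsΔPerm : List Γ → (Γ ↔ Γ) → Set
  IsΔPerm Δ φ = map (λ a → Inverse.to φ a -Γ a) elems ↭ Δ

  Δ₀ : List Γ
  Δ₀ = zeroΓ ∷ filter (λ γ → ¬? (γ ≟Γ embed 0 n)) elems

  fixPt : Γ
  fixPt = Cyclic.neg m (ι m ((m ∸ 1) Data.Nat./ 2))
        , ι (2 * n) (((n + 1) Data.Nat./ 2) + ((m ∸ 1) Data.Nat./ 2) * n)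

-- Call ψ : Γ → Γ, on Γ = ℤ_a × ℤ_2b, a near-orthomorphism at P ≠ 0 if it is injective, fixes 0 and P,
-- and its differences ψ u - u for u ≠ P are pairwise distinct and avoid t = (0, b); its differences are
-- then exactly Δ. Near-orthomorphisms are transported along group isomorphisms (negation, and
-- ℤ_a × ℤ_2b ≅ ℤ_b × ℤ_2a for odd a, b), exist on ℤ_1 × ℤ_2N at (0, c) for 2c ∈ {N, N + 1} by a double
-- reflection, and lift from ℤ_1 × ℤ_2n at (0, p) to ℤ_m × ℤ_2n at (k + 1, p) when m = 2k + 1. The
-- required fixed point is (k + 1, c + kn) with c = ⌊(n + 1)/2⌋. If k is even, c + kn ≡ c and a reflection
-- is lifted; if k is odd and n even, c + kn ≡ -c and a negated reflection is lifted. If k and n are odd,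
-- a reflection on ℤ_1 × ℤ_2m (n ≡ 1 mod 4) or on ℤ_1 × ℤ_2 (n ≡ 3 mod 4) is lifted to ℤ_n × ℤ_2m or
-- ℤ_n × ℤ_2 and swapped; in the second case the result on ℤ_1 × ℤ_2n is lifted once more.

module Submission where

open import Defs
open import Data.Nat using (ℕ; NonZero; zero; suc; z≤n; s≤s; _+_; _*_; _∸_; _≤_; _<_; _/_; _%_; _≤?_; _<?_; >-nonZero⁻¹)
open import Data.Nat.Properties
open import Data.Nat.DivMod using (m≡m%n+[m/n]*n; [m+kn]%n≡m%n; m<n⇒m%n≡m; m*n%n≡0; m%n<n; +-distrib-/; m<n⇒m/n≡0; m*n/n≡m)
open import Data.Nat.Divisibility using (_∣_; divides; m∣m*n; n∣m*n)
open import Data.Nat.Tactic.RingSolver using (solve-∀; solve)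
open import Algebra.Properties.CommutativeSemigroup +-commutativeSemigroup using (interchange; xy∙z≈xz∙y)
open import Data.Fin using (Fin; toℕ) renaming (zero to 0F)
open import Data.Fin.Properties using (toℕ-fromℕ<; toℕ-injective; toℕ<n) renaming (_≟_ to _≟ᶠ_)
open import Data.Product using (∃; Σ-syntax; _×_; _,_; proj₁; proj₂)
open import Data.Sum using (_⊎_; inj₁; inj₂; [_,_]′)
open import Data.Empty using (⊥; ⊥-elim)
open import Data.List using (List; []; _∷_; _++_; [_]; map; filter; length; allFin; cartesianProduct)
open import Data.List.Properties using (length-map; length-++; length-tabulate; map-∘; map-cong)
open import Data.List.Relation.Unary.Any using (here; there)
open import Data.List.Relation.Unary.Unique.Propositional using (Unique)
import Data.List.Relation.Unary.Unique.Propositional.Properties as Unique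
open import Data.List.Relation.Binary.Permutation.Propositional using (_↭_; ↭-refl; ↭-prep; ↭-swap; ↭-trans; ↭-sym; ↭⇒↭ₛ)
open import Data.List.Relation.Binary.Permutation.Propositional.Properties using (shift; ∈-resp-↭; ↭-length; map⁺)
open import Data.List.Relation.Binary.Permutation.Setoid.Properties using (Unique-resp-↭)
open import Data.List.Membership.Propositional using (_∈_)
open import Data.List.Membership.Propositional.Properties using (∈-∃++; ∈-map⁻; ∈-allFin; ∈-cartesianProduct⁺)
open import Function.Base using (_∘_)
open import Function.Bundles using (_↔_; Inverse; mk↔ₛ′)
open import Function.Definitions using (Injective)
open import Relation.Binary.Bundles using (Setoid)
open import Relation.Binary.Structures using (IsEquivalence)
open import Relation.Binary.Definitions using (DecidableEquality)
open import Relation.Binary.PropositionalEquality using (_≡_; _≢_; refl; sym; trans; cong; cong₂; subst; subst₂; setoid; module ≡-Reasoning)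
open import Relation.Nullary using (¬_; Dec; yes; no; ¬?; contradiction)


infix 4 _≡_[mod_]
record _≡_[mod_] (x y k : ℕ) : Set where
  constructor congruent
  field
    a b : ℕ
    equation : x + a * k ≡ y + b * k

module _ {k : ℕ} where

  mod-reflexive : ∀ {x y} → x ≡ y → x ≡ y [mod k ]
  mod-reflexive {x} refl = congruent 0 0 refl

  mod-refl : ∀ {x} → x ≡ x [mod k ]
  mod-refl = mod-reflexive refl

  mod-sym : ∀ {x y} → x ≡ y [mod k ] → y ≡ x [mod k ]
  mod-sym (congruent a b e) = congruent b a (sym e)

  mod-trans : ∀ {x y z} → x ≡ y [mod k ] → y ≡ z [mod k ] → x ≡ z [mod k ]
  mod-trans {x} {y} {z} (congruent a b e) (congruent c d f) = congruent (a + c) (b + d) (begin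
    x + (a + c) * k       ≡⟨ solve (x ∷ a ∷ c ∷ k ∷ []) ⟩
    (x + a * k) + c * k   ≡⟨ cong (_+ c * k) e ⟩
    (y + b * k) + c * k   ≡⟨ solve (y ∷ b ∷ c ∷ k ∷ []) ⟩
    (y + c * k) + b * k   ≡⟨ cong (_+ b * k) f ⟩
    (z + d * k) + b * k   ≡⟨ solve (z ∷ d ∷ b ∷ k ∷ []) ⟩
    z + (b + d) * k       ∎)
    where open ≡-Reasoning

mod-isEquivalence : ∀ k → IsEquivalence (_≡_[mod k ])
mod-isEquivalence k = record { refl = mod-refl ; sym = mod-sym ; trans = mod-trans }

mod-setoid : ℕ → Setoid _ _
mod-setoid k = record { isEquivalence = mod-isEquivalence k }

module mod-Reasoning (k : ℕ) where
  open import Relation.Binary.Reasoning.Setoid (mod-setoid k) public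

module _ {k : ℕ} where

  +-cong-mod : ∀ {x y u v} → x ≡ y [mod k ] → u ≡ v [mod k ] → x + u ≡ y + v [mod k ]
  +-cong-mod {x} {y} {u} {v} (congruent a b e) (congruent c d f) = congruent (a + c) (b + d) (begin
    x + u + (a + c) * k           ≡⟨ solve (x ∷ u ∷ a ∷ c ∷ k ∷ []) ⟩
    (x + a * k) + (u + c * k)     ≡⟨ cong₂ _+_ e f ⟩
    (y + b * k) + (v + d * k)     ≡⟨ solve (y ∷ v ∷ b ∷ d ∷ k ∷ []) ⟩
    y + v + (b + d) * k           ∎)
    where open ≡-Reasoning

  *-cong-mod : ∀ {x y u v} → x ≡ y [mod k ] → u ≡ v [mod k ] → x * u ≡ y * v [mod k ]
  *-cong-mod {x} {y} {u} {v} (congruent a b e) (congruent c d f) =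
    congruent (a * u + x * c + a * c * k) (b * v + y * d + b * d * k) (begin
      x * u + (a * u + x * c + a * c * k) * k   ≡⟨ solve (x ∷ u ∷ a ∷ c ∷ k ∷ []) ⟩
      (x + a * k) * (u + c * k)                 ≡⟨ cong₂ _*_ e f ⟩
      (y + b * k) * (v + d * k)                 ≡⟨ solve (y ∷ v ∷ b ∷ d ∷ k ∷ []) ⟩
      y * v + (b * v + y * d + b * d * k) * k   ∎)
    where open ≡-Reasoning

  +-congˡ-mod : ∀ c {x y} → x ≡ y [mod k ] → c + x ≡ c + y [mod k ]
  +-congˡ-mod c = +-cong-mod (mod-refl {x = c})

  +-congʳ-mod : ∀ c {x y} → x ≡ y [mod k ] → x + c ≡ y + c [mod k ]
  +-congʳ-mod c p = +-cong-mod p (mod-refl {x = c})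

  *-congˡ-mod : ∀ c {x y} → x ≡ y [mod k ] → c * x ≡ c * y [mod k ]
  *-congˡ-mod c = *-cong-mod (mod-refl {x = c})

  *-congʳ-mod : ∀ c {x y} → x ≡ y [mod k ] → x * c ≡ y * c [mod k ]
  *-congʳ-mod c p = *-cong-mod p (mod-refl {x = c})

  +-cancelʳ-mod : ∀ z {x y} → x + z ≡ y + z [mod k ] → x ≡ y [mod k ]
  +-cancelʳ-mod z {x} {y} (congruent a b e) = congruent a b (+-cancelʳ-≡ z _ _ (begin
    x + a * k + z    ≡⟨ solve (x ∷ a ∷ k ∷ z ∷ []) ⟩
    x + z + a * k    ≡⟨ e ⟩
    y + z + b * k    ≡⟨ solve (y ∷ z ∷ b ∷ k ∷ []) ⟩
    y + b * k + z    ∎))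
    where open ≡-Reasoning

  +-cancelˡ-mod : ∀ z {x y} → z + x ≡ z + y [mod k ] → x ≡ y [mod k ]
  +-cancelˡ-mod z {x} {y} p = +-cancelʳ-mod z (subst₂ _≡_[mod k ] (+-comm z x) (+-comm z y) p)

  *k≡0-mod : ∀ q → q * k ≡ 0 [mod k ]
  *k≡0-mod q = congruent 0 q (+-identityʳ (q * k))

  k≡0-mod : k ≡ 0 [mod k ]
  k≡0-mod = subst (_≡ 0 [mod k ]) (*-identityˡ k) (*k≡0-mod 1)

  *-cancelˡ-mod-unit : ∀ ν ν′ {x y} → ν′ * ν ≡ 1 [mod k ] → ν * x ≡ ν * y [mod k ] → x ≡ y [mod k ]
  *-cancelˡ-mod-unit ν ν′ {x} {y} inv p = begin
    x              ≡⟨ *-identityˡ x ⟨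
    1 * x          ≈⟨ *-congʳ-mod x inv ⟨
    ν′ * ν * x     ≡⟨ *-assoc ν′ ν x ⟩
    ν′ * (ν * x)   ≈⟨ *-congˡ-mod ν′ p ⟩
    ν′ * (ν * y)   ≡⟨ *-assoc ν′ ν y ⟨
    ν′ * ν * y     ≈⟨ *-congʳ-mod y inv ⟩
    1 * y          ≡⟨ *-identityˡ y ⟩
    y              ∎
    where open mod-Reasoning k

mod-∣ : ∀ {d k x y} → d ∣ k → x ≡ y [mod k ] → x ≡ y [mod d ]
mod-∣ {d} {x = x} {y} (divides q refl) (congruent a b e) = congruent (a * q) (b * q) (begin
  x + a * q * d      ≡⟨ cong (x +_) (*-assoc a q d) ⟩
  x + a * (q * d)    ≡⟨ e ⟩
  y + b * (q * d)    ≡⟨ cong (y +_) (*-assoc b q d) ⟨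
  y + b * q * d      ∎)
  where open ≡-Reasoning

mod-1 : ∀ x y → x ≡ y [mod 1 ]
mod-1 x y = congruent y x (solve (x ∷ y ∷ []))

*-scale-mod : ∀ c {k x y} → x ≡ y [mod k ] → c * x ≡ c * y [mod c * k ]
*-scale-mod c {k} {x} {y} (congruent a b e) = congruent a b (begin
  c * x + a * (c * k)   ≡⟨ solve (c ∷ x ∷ a ∷ k ∷ []) ⟩
  c * (x + a * k)       ≡⟨ cong (c *_) e ⟩
  c * (y + b * k)       ≡⟨ solve (c ∷ y ∷ b ∷ k ∷ []) ⟩
  c * y + b * (c * k)   ∎)
  where open ≡-Reasoning

*-scaleʳ-mod : ∀ c {k x y} → x ≡ y [mod k ] → x * c ≡ y * c [mod k * c ]
*-scaleʳ-mod c {k} {x} {y} p = subst₂ _≡_[mod k * c ] (*-comm c x) (*-comm c y)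
  (subst (c * x ≡ c * y [mod_]) (*-comm c k) (*-scale-mod c p))

*-cancelˡ-scaled-mod : ∀ c {k x y} .{{_ : NonZero c}} → c * x ≡ c * y [mod c * k ] → x ≡ y [mod k ]
*-cancelˡ-scaled-mod c {k} {x} {y} (congruent a b e) = congruent a b (*-cancelˡ-≡ _ _ c (begin
  c * (x + a * k)       ≡⟨ solve (c ∷ x ∷ a ∷ k ∷ []) ⟩
  c * x + a * (c * k)   ≡⟨ e ⟩
  c * y + b * (c * k)   ≡⟨ solve (c ∷ y ∷ b ∷ k ∷ []) ⟩
  c * (y + b * k)       ∎))
  where open ≡-Reasoning

module _ {k : ℕ} .{{_ : NonZero k}} where

  %-mod : ∀ x → x % k ≡ x [mod k ]
  %-mod x = congruent (x / k) 0 (trans (sym (m≡m%n+[m/n]*n x k)) (sym (+-identityʳ x)))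

  mod⇒%≡ : ∀ {x y} → x ≡ y [mod k ] → x % k ≡ y % k
  mod⇒%≡ {x} {y} (congruent a b e) = begin
    x % k               ≡⟨ [m+kn]%n≡m%n x a k ⟨
    (x + a * k) % k     ≡⟨ cong (_% k) e ⟩
    (y + b * k) % k     ≡⟨ [m+kn]%n≡m%n y b k ⟩
    y % k               ∎
    where open ≡-Reasoning

  mod-<⇒≡ : ∀ {x y} → x ≡ y [mod k ] → x < k → y < k → x ≡ y
  mod-<⇒≡ {x} {y} p x<k y<k = begin
    x       ≡⟨ m<n⇒m%n≡m x<k ⟨
    x % k   ≡⟨ mod⇒%≡ p ⟩
    y % k   ≡⟨ m<n⇒m%n≡m y<k ⟩
    y       ∎
    where open ≡-Reasoning

1+2x≢2y-mod2 : ∀ x y → ¬ 1 + x * 2 ≡ 0 + y * 2 [mod 2 ]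
1+2x≢2y-mod2 x y p = 0≢1+n (begin
  0                 ≡⟨ [m+kn]%n≡m%n 0 y 2 ⟨
  (0 + y * 2) % 2   ≡⟨ mod⇒%≡ p ⟨
  (1 + x * 2) % 2   ≡⟨ [m+kn]%n≡m%n 1 x 2 ⟩
  1                 ∎)
  where open ≡-Reasoning

odd≢even-mod : ∀ x y n → ¬ 2 * x + 1 ≡ 2 * y [mod 2 * n ]
odd≢even-mod x y n p = 1+2x≢2y-mod2 x y (mod-∣ (m∣m*n n) (begin
  1 + x * 2   ≡⟨ solve (x ∷ []) ⟩
  2 * x + 1   ≈⟨ p ⟩
  2 * y       ≡⟨ solve (y ∷ []) ⟩
  0 + y * 2   ∎))
  where open mod-Reasoning (2 * n)

n≢0-mod2n : ∀ n .{{_ : NonZero n}} → ¬ n ≡ 0 [mod 2 * n ]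
n≢0-mod2n n@(suc _) p = 1+n≢0 (mod-<⇒≡ p (subst (n <_) (*-comm n 2) (m<m*n n 2 ≤-refl)) (>-nonZero⁻¹ (2 * n)))
  where instance _ = m*n≢0 2 n

module _ {m : ℕ} (k : ℕ) (m-odd : m ≡ 1 + 2 * k) where

  1+k*2≡1-mod-odd : suc k * 2 ≡ 1 [mod m ]
  1+k*2≡1-mod-odd = congruent 0 1 (begin
    suc k * 2 + 0 * m   ≡⟨ solve (k ∷ m ∷ []) ⟩
    1 + 1 * (1 + 2 * k) ≡⟨ cong (λ z → 1 + 1 * z) m-odd ⟨
    1 + 1 * m           ∎)
    where open ≡-Reasoning

  2*-cancelˡ-mod-odd : ∀ {x y} → 2 * x ≡ 2 * y [mod m ] → x ≡ y [mod m ]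
  2*-cancelˡ-mod-odd = *-cancelˡ-mod-unit 2 (suc k) 1+k*2≡1-mod-odd

  *-odd≡-mod2 : ∀ a → a * m ≡ a [mod 2 ]
  *-odd≡-mod2 a = congruent 0 (a * k) (begin
    a * m + 0 * 2     ≡⟨ cong (λ z → a * z + 0 * 2) m-odd ⟩
    a * (1 + 2 * k) + 0 * 2 ≡⟨ solve (a ∷ k ∷ []) ⟩
    a + a * k * 2     ∎)
    where open ≡-Reasoning

  *-odd-cancelʳ-mod2 : ∀ {a a′} → a * m ≡ a′ * m [mod 2 ] → a ≡ a′ [mod 2 ]
  *-odd-cancelʳ-mod2 {a} {a′} p = mod-trans (mod-sym (*-odd≡-mod2 a)) (mod-trans p (*-odd≡-mod2 a′))

  mod-odd∧mod2⇒mod2*odd : ∀ {x y} → x ≡ y [mod m ] → x ≡ y [mod 2 ] → x ≡ y [mod 2 * m ]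
  mod-odd∧mod2⇒mod2*odd {x} {y} (congruent a a′ e) x≡y = lift (*-odd-cancelʳ-mod2 (+-cancelˡ-mod y
    (mod-trans (+-congʳ-mod (a * m) (mod-sym x≡y)) (mod-reflexive e))))
    where
    open ≡-Reasoning
    lift : a ≡ a′ [mod 2 ] → x ≡ y [mod 2 * m ]
    lift (congruent g f e′) = congruent f g (+-cancelʳ-≡ (a′ * m) _ _ (begin
      x + f * (2 * m) + a′ * m   ≡⟨ solve (x ∷ f ∷ m ∷ a′ ∷ []) ⟩
      x + (a′ + f * 2) * m       ≡⟨ cong (λ z → x + z * m) e′ ⟨
      x + (a + g * 2) * m        ≡⟨ solve (x ∷ a ∷ g ∷ m ∷ []) ⟩
      x + a * m + g * (2 * m)    ≡⟨ cong (_+ g * (2 * m)) e ⟩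
      y + a′ * m + g * (2 * m)   ≡⟨ solve (y ∷ a′ ∷ m ∷ g ∷ []) ⟩
      y + g * (2 * m) + a′ * m   ∎))

mod-window : ∀ {N} .{{_ : NonZero N}} s {y y′} → s ≤ y → y < s + N → s ≤ y′ → y′ < s + N →
             y ≡ y′ [mod N ] → y ≡ y′
mod-window {N} s {y} {y′} s≤y y<s+N s≤y′ y′<s+N y≡y′ = begin
  y              ≡⟨ m+[n∸m]≡n s≤y ⟨
  s + (y ∸ s)    ≡⟨ cong (s +_) (mod-<⇒≡ (+-cancelˡ-mod s (subst₂ _≡_[mod N ] (sym (m+[n∸m]≡n s≤y)) (sym (m+[n∸m]≡n s≤y′)) y≡y′))
                                          (offset< s≤y y<s+N) (offset< s≤y′ y′<s+N)) ⟩
  s + (y′ ∸ s)   ≡⟨ m+[n∸m]≡n s≤y′ ⟩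
  y′             ∎
  where
  open ≡-Reasoning
  offset< : ∀ {z} → s ≤ z → z < s + N → z ∸ s < N
  offset< {z} s≤z z<s+N = +-cancelˡ-< s (z ∸ s) N (subst (_< s + N) (sym (m+[n∸m]≡n s≤z)) z<s+N)

module _ (n : ℕ) .{{_ : NonZero n}} where

  n*b≡n*b′⇒b≡b′ : ∀ {b b′} → b ≤ 1 → b′ ≤ 1 → n * b ≡ n * b′ [mod 2 * n ] → b ≡ b′
  n*b≡n*b′⇒b≡b′ z≤n       z≤n       _ = refl
  n*b≡n*b′⇒b≡b′ (s≤s z≤n) (s≤s z≤n) _ = refl
  n*b≡n*b′⇒b≡b′ z≤n       (s≤s z≤n) p = contradiction (mod-sym (subst₂ _≡_[mod 2 * n ] (*-zeroʳ n) (*-identityʳ n) p)) (n≢0-mod2n n)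
  n*b≡n*b′⇒b≡b′ (s≤s z≤n) z≤n       p = contradiction (subst₂ _≡_[mod 2 * n ] (*-identityʳ n) (*-zeroʳ n) p) (n≢0-mod2n n)

  E+n*b≡n*b′⇒E≡0∨n : ∀ {b b′} E → b ≤ 1 → b′ ≤ 1 → E + n * b ≡ n * b′ [mod 2 * n ] → E ≡ 0 [mod 2 * n ] ⊎ E ≡ n [mod 2 * n ]
  E+n*b≡n*b′⇒E≡0∨n E z≤n z≤n p = inj₁ (+-cancelʳ-mod (n * 0) p)
  E+n*b≡n*b′⇒E≡0∨n E (s≤s z≤n) (s≤s z≤n) p = inj₁ (+-cancelʳ-mod (n * 1) p)
  E+n*b≡n*b′⇒E≡0∨n E z≤n (s≤s z≤n) p = inj₂ (begin
    E           ≡⟨ +-identityʳ E ⟨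
    E + 0       ≡⟨ cong (E +_) (*-zeroʳ n) ⟨
    E + n * 0   ≈⟨ p ⟩
    n * 1       ≡⟨ *-identityʳ n ⟩
    n           ∎)
    where open mod-Reasoning (2 * n)
  E+n*b≡n*b′⇒E≡0∨n E (s≤s z≤n) z≤n p = inj₂ (begin
    E                 ≡⟨ +-identityʳ E ⟨
    E + 0             ≈⟨ +-congˡ-mod E k≡0-mod ⟨
    E + 2 * n         ≡⟨ solve (E ∷ n ∷ []) ⟩
    E + n * 1 + n     ≈⟨ +-congʳ-mod n p ⟩
    n * 0 + n         ≡⟨ cong (_+ n) (*-zeroʳ n) ⟩
    n                 ∎)
    where open mod-Reasoning (2 * n)

module _ {k : ℕ} .{{_ : NonZero k}} where
  open Cyclic k

  toℕ-ι : ∀ x → toℕ (ι k x) ≡ x % k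
  toℕ-ι x = toℕ-fromℕ< (m%n<n x k)

  toℕ-ι-mod : ∀ x → toℕ (ι k x) ≡ x [mod k ]
  toℕ-ι-mod x = subst (_≡ x [mod k ]) (sym (toℕ-ι x)) (%-mod x)

  toℕ-ι-< : ∀ {x} → x < k → toℕ (ι k x) ≡ x
  toℕ-ι-< {x} x<k = trans (toℕ-ι x) (m<n⇒m%n≡m x<k)

  toℕ-ι-0 : toℕ (ι k 0) ≡ 0
  toℕ-ι-0 = toℕ-ι-< (>-nonZero⁻¹ k)

  toℕ-injective-mod : ∀ {a b : Fin k} → toℕ a ≡ toℕ b [mod k ] → a ≡ b
  toℕ-injective-mod {a} {b} p = toℕ-injective (mod-<⇒≡ p (toℕ<n a) (toℕ<n b))

  ι-cong : ∀ {x y} → x ≡ y [mod k ] → ι k x ≡ ι k y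
  ι-cong {x} {y} p = toℕ-injective-mod (mod-trans (toℕ-ι-mod x) (mod-trans p (mod-sym (toℕ-ι-mod y))))

  ι-injective-mod : ∀ {x y} → ι k x ≡ ι k y → x ≡ y [mod k ]
  ι-injective-mod {x} {y} e = mod-trans (mod-sym (toℕ-ι-mod x)) (subst (λ z → toℕ z ≡ y [mod k ]) (sym e) (toℕ-ι-mod y))

  ι-toℕ : ∀ (a : Fin k) → ι k (toℕ a) ≡ a
  ι-toℕ a = toℕ-injective-mod (toℕ-ι-mod (toℕ a))

  ι≡⇒toℕ-mod : ∀ {a : Fin k} {x} → a ≡ ι k x → toℕ a ≡ x [mod k ]
  ι≡⇒toℕ-mod {x = x} refl = toℕ-ι-mod x

  neg-mod : ∀ (a : Fin k) → toℕ (neg a) + toℕ a ≡ 0 [mod k ]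
  neg-mod a = begin
    toℕ (neg a) + toℕ a   ≈⟨ +-congʳ-mod (toℕ a) (toℕ-ι-mod (k ∸ toℕ a)) ⟩
    k ∸ toℕ a + toℕ a     ≡⟨ m∸n+n≡m (<⇒≤ (toℕ<n a)) ⟩
    k                     ≈⟨ k≡0-mod ⟩
    0                     ∎
    where open mod-Reasoning k

  sub-mod : ∀ (a b : Fin k) → toℕ (sub a b) + toℕ b ≡ toℕ a [mod k ]
  sub-mod a b = begin
    toℕ (sub a b) + toℕ b               ≈⟨ +-congʳ-mod (toℕ b) (toℕ-ι-mod (toℕ a + toℕ (neg b))) ⟩
    toℕ a + toℕ (neg b) + toℕ b         ≡⟨ +-assoc (toℕ a) _ (toℕ b) ⟩
    toℕ a + (toℕ (neg b) + toℕ b)       ≈⟨ +-congˡ-mod (toℕ a) (neg-mod b) ⟩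
    toℕ a + 0                           ≡⟨ +-identityʳ (toℕ a) ⟩
    toℕ a                               ∎
    where open mod-Reasoning k

  sub-unique : ∀ {a b c : Fin k} → toℕ c + toℕ b ≡ toℕ a [mod k ] → c ≡ sub a b
  sub-unique {a} {b} p = toℕ-injective-mod (+-cancelʳ-mod (toℕ b) (mod-trans p (mod-sym (sub-mod a b))))

  sub-self : ∀ (a : Fin k) → sub a a ≡ ι k 0
  sub-self a = sym (sub-unique (+-congʳ-mod (toℕ a) (toℕ-ι-mod 0)))

  neg-unique : ∀ {a b : Fin k} → toℕ b + toℕ a ≡ 0 [mod k ] → b ≡ neg a
  neg-unique {a} p = toℕ-injective-mod (+-cancelʳ-mod (toℕ a) (mod-trans p (mod-sym (neg-mod a))))

  neg-involutive : ∀ (a : Fin k) → neg (neg a) ≡ a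
  neg-involutive a = sym (neg-unique (mod-trans (mod-reflexive (+-comm (toℕ a) _)) (neg-mod a)))

  neg-injective : ∀ {a b : Fin k} → neg a ≡ neg b → a ≡ b
  neg-injective {a} {b} e = trans (sym (neg-involutive a)) (trans (cong neg e) (neg-involutive b))

  neg-sub : ∀ (a b : Fin k) → neg (sub a b) ≡ sub (neg a) (neg b)
  neg-sub a b = sub-unique (+-cancelʳ-mod (toℕ (sub a b) + toℕ b) (begin
    toℕ (neg (sub a b)) + toℕ (neg b) + (toℕ (sub a b) + toℕ b)
      ≡⟨ interchange (toℕ (neg (sub a b))) (toℕ (neg b)) (toℕ (sub a b)) (toℕ b) ⟩
    (toℕ (neg (sub a b)) + toℕ (sub a b)) + (toℕ (neg b) + toℕ b)
      ≈⟨ +-cong-mod (neg-mod (sub a b)) (neg-mod b) ⟩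
    0
      ≈⟨ neg-mod a ⟨
    toℕ (neg a) + toℕ a
      ≈⟨ +-congˡ-mod (toℕ (neg a)) (sub-mod a b) ⟨
    toℕ (neg a) + (toℕ (sub a b) + toℕ b) ∎))
    where open mod-Reasoning k

  sub≡sub⇒mod : ∀ {a b a′ b′ : Fin k} → sub a b ≡ sub a′ b′ → toℕ a + toℕ b′ ≡ toℕ a′ + toℕ b [mod k ]
  sub≡sub⇒mod {a} {b} {a′} {b′} e = begin
    toℕ a + toℕ b′                   ≈⟨ +-congʳ-mod (toℕ b′) (sub-mod a b) ⟨
    toℕ (sub a b) + toℕ b + toℕ b′   ≡⟨ xy∙z≈xz∙y (toℕ (sub a b)) (toℕ b) (toℕ b′) ⟩
    toℕ (sub a b) + toℕ b′ + toℕ b   ≡⟨ cong (λ s → toℕ s + toℕ b′ + toℕ b) e ⟩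
    toℕ (sub a′ b′) + toℕ b′ + toℕ b ≈⟨ +-congʳ-mod (toℕ b) (sub-mod a′ b′) ⟩
    toℕ a′ + toℕ b                   ∎
    where open mod-Reasoning k

  neg-ι : ∀ {x y} → x + y ≡ 0 [mod k ] → neg (ι k y) ≡ ι k x
  neg-ι {x} {y} x+y≡0 = sym (neg-unique (mod-trans (+-cong-mod (toℕ-ι-mod x) (toℕ-ι-mod y)) x+y≡0))

Fin1-irrelevant : ∀ (i j : Fin 1) → i ≡ j
Fin1-irrelevant 0F 0F = refl

module Enumerations where
  open import Data.List.Relation.Unary.All using (All; []; _∷_) renaming (lookup to All-lookup)
  open import Data.List.Relation.Unary.AllPairs using (_∷_)

  unique-⊆⇒↭ : ∀ {A : Set} (xs ys : List A) → Unique xs → Unique ys →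
               (∀ {z} → z ∈ xs → z ∈ ys) → length xs ≡ length ys → xs ↭ ys
  unique-⊆⇒↭ [] [] _ _ _ _ = ↭-refl
  unique-⊆⇒↭ (x ∷ xs) ys (x∉xs ∷ xs!) ys! xs⊆ys len with ∈-∃++ (xs⊆ys (here refl))
  ... | as , bs , refl = ↭-trans (↭-prep x (unique-⊆⇒↭ xs (as ++ bs) xs! as++bs! xs⊆as++bs len′)) (↭-sym moveX)
    where
    moveX : as ++ [ x ] ++ bs ↭ x ∷ as ++ bs
    moveX = shift x as bs
    as++bs! : Unique (as ++ bs)
    as++bs! with Unique-resp-↭ (setoid _) (↭⇒↭ₛ moveX) ys!
    ... | _ ∷ u = u
    xs⊆as++bs : ∀ {z} → z ∈ xs → z ∈ as ++ bs
    xs⊆as++bs {z} z∈xs with ∈-resp-↭ moveX (xs⊆ys (there z∈xs))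
    ... | here z≡x = ⊥-elim (All-lookup x∉xs z∈xs (sym z≡x))
    ... | there z∈ = z∈
    len′ : length xs ≡ length (as ++ bs)
    len′ = suc-injective (trans len (↭-length moveX))

  record Enumeration (A : Set) : Set where
    field
      elements : List A
      unique   : Unique elements
      complete : ∀ a → a ∈ elements

  module _ {A B : Set} (EA : Enumeration A) (EB : Enumeration B) (f : A → B) (f-inj : Injective _≡_ _≡_ f)
           (same-size : length (Enumeration.elements EA) ≡ length (Enumeration.elements EB)) where
    open Enumeration

    map-injective-↭ : map f (elements EA) ↭ elements EB
    map-injective-↭ = unique-⊆⇒↭ _ _ (Unique.map⁺ f-inj (unique EA)) (unique EB) (λ _ → complete EB _)
                        (trans (length-map f (elements EA)) same-size)

    private
      preimage : ∀ b → ∃ λ a → a ∈ elements EA × b ≡ f a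
      preimage b = ∈-map⁻ f (∈-resp-↭ (↭-sym map-injective-↭) (complete EB b))

    injective⇒↔ : A ↔ B
    injective⇒↔ = mk↔ₛ′ f f⁻¹ f∘f⁻¹ (λ a → f-inj (f∘f⁻¹ (f a)))
      where
      f⁻¹ : B → A
      f⁻¹ b = proj₁ (preimage b)
      f∘f⁻¹ : ∀ b → f (f⁻¹ b) ≡ b
      f∘f⁻¹ b = sym (proj₂ (proj₂ (preimage b)))

  length-cartesianProduct : ∀ {A B : Set} (xs : List A) (ys : List B) →
                            length (cartesianProduct xs ys) ≡ length xs * length ys
  length-cartesianProduct [] ys = refl
  length-cartesianProduct (x ∷ xs) ys = trans (length-++ (map (x ,_) ys))
    (cong₂ _+_ (length-map (x ,_) ys) (length-cartesianProduct xs ys))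

  Fin×Fin-enumeration : ∀ a b → Enumeration (Fin a × Fin b)
  Fin×Fin-enumeration a b = record
    { elements = cartesianProduct (allFin a) (allFin b)
    ; unique   = Unique.cartesianProduct⁺ (Unique.allFin⁺ a) (Unique.allFin⁺ b)
    ; complete = λ (x , y) → ∈-cartesianProduct⁺ (∈-allFin x) (∈-allFin y)
    }

  length-Fin×Fin : ∀ a b → length (Enumeration.elements (Fin×Fin-enumeration a b)) ≡ a * b
  length-Fin×Fin a b = trans (length-cartesianProduct (allFin a) (allFin b))
    (cong₂ _*_ (length-tabulate {n = a} (λ i → i)) (length-tabulate {n = b} (λ i → i)))

  module _ {A : Set} (_≟_ : DecidableEquality A) (t z : A) where

    replace : A → A
    replace a with a ≟ t
    ... | yes _ = z
    ... | no _  = a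

    replace-≢ : ∀ {a} → ¬ a ≡ t → replace a ≡ a
    replace-≢ {a} a≢t with a ≟ t
    ... | yes a≡t = ⊥-elim (a≢t a≡t)
    ... | no _    = refl

    replace-t : replace t ≡ z
    replace-t with t ≟ t
    ... | yes _   = refl
    ... | no t≢t  = ⊥-elim (t≢t refl)

    private
      map-replace-∉ : ∀ xs → All (λ x → ¬ t ≡ x) xs → map replace xs ≡ filter (λ a → ¬? (a ≟ t)) xs
      map-replace-∉ [] [] = refl
      map-replace-∉ (x ∷ xs) (t≢x ∷ t∉xs) with x ≟ t
      ... | yes x≡t = ⊥-elim (t≢x (sym x≡t))
      ... | no _    = cong (x ∷_) (map-replace-∉ xs t∉xs)

    map-replace-↭ : ∀ xs → Unique xs → t ∈ xs → map replace xs ↭ z ∷ filter (λ a → ¬? (a ≟ t)) xs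
    map-replace-↭ (x ∷ xs) (t∉xs ∷ xs!) t∈ with x ≟ t
    map-replace-↭ (x ∷ xs) (t∉xs ∷ xs!) t∈         | yes refl = ↭-prep z (subst (_↭ _) (sym (map-replace-∉ xs t∉xs)) ↭-refl)
    map-replace-↭ (x ∷ xs) (t∉xs ∷ xs!) (here t≡x) | no x≢t   = ⊥-elim (x≢t (sym t≡x))
    map-replace-↭ (x ∷ xs) (t∉xs ∷ xs!) (there t∈) | no _     = ↭-trans (↭-prep x (map-replace-↭ xs xs! t∈)) (↭-swap x z ↭-refl)

open Enumerations

module _ (a b : ℕ) .{{_ : NonZero a}} .{{_ : NonZero b}} where
  open Grp a b

  t : Γ
  t = embed 0 b

  embed-cong : ∀ {x x′ y y′} → x ≡ x′ [mod a ] → y ≡ y′ [mod 2 * b ] → embed x y ≡ embed x′ y′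
  embed-cong x≡x′ y≡y′ = cong₂ _,_ (ι-cong x≡x′) (ι-cong y≡y′)

  enumeration : Enumeration Γ
  enumeration = Fin×Fin-enumeration a (2 * b)

  -Γ-self : ∀ u → u -Γ u ≡ zeroΓ
  -Γ-self (x , y) = cong₂ _,_ (sub-self x) (sub-self y)

  -- ψ P - P = ψ 0 - 0 = (0, 0) are the two copies of (0, 0) in Δ₀; the last two fields give the rest.
  record NearOrthomorphism (P : Γ) : Set where
    field
      ψ              : Γ → Γ
      injective      : Injective _≡_ _≡_ ψ
      fixes-0        : ψ zeroΓ ≡ zeroΓ
      fixes-P        : ψ P ≡ P
      P≢0            : ¬ P ≡ zeroΓ
      diff-injective : ∀ u v → ¬ u ≡ P → ¬ v ≡ P → ψ u -Γ u ≡ ψ v -Γ v → u ≡ v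
      diff≢t         : ∀ u → ¬ u ≡ P → ¬ ψ u -Γ u ≡ t

  module _ {P : Γ} (N : NearOrthomorphism P) where
    open NearOrthomorphism N

    private
      σ : Γ → Γ
      σ u with u ≟Γ P
      ... | yes _ = t
      ... | no _  = ψ u -Γ u

      σ-injective : Injective _≡_ _≡_ σ
      σ-injective {u} {v} e with u ≟Γ P | v ≟Γ P
      ... | yes u≡P | yes v≡P = trans u≡P (sym v≡P)
      ... | yes _   | no v≢P  = ⊥-elim (diff≢t v v≢P (sym e))
      ... | no u≢P  | yes _   = ⊥-elim (diff≢t u u≢P e)
      ... | no u≢P  | no v≢P  = diff-injective u v u≢P v≢P e

      replace-σ : ∀ u → ψ u -Γ u ≡ replace _≟Γ_ t zeroΓ (σ u)
      replace-σ u with u ≟Γ P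
      ... | yes refl = trans (cong (_-Γ u) fixes-P) (trans (-Γ-self u) (sym (replace-t _≟Γ_ t zeroΓ)))
      ... | no u≢P   = sym (replace-≢ _≟Γ_ t zeroΓ (diff≢t u u≢P))

    nearOrthomorphism⇒ΔPerm : Σ[ φ ∈ (Γ ↔ Γ) ] (IsΔPerm Δ₀ φ × Inverse.to φ zeroΓ ≡ zeroΓ × Inverse.to φ P ≡ P)
    nearOrthomorphism⇒ΔPerm = injective⇒↔ enumeration enumeration ψ injective refl , differences , fixes-0 , fixes-P
      where
      open Enumeration enumeration
      differences : map (λ u → ψ u -Γ u) elems ↭ Δ₀
      differences = subst (_↭ Δ₀) (sym (trans (map-cong replace-σ elems) (map-∘ elems)))
        (↭-trans (map⁺ _ (map-injective-↭ enumeration enumeration σ σ-injective refl))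
                 (map-replace-↭ _≟Γ_ t zeroΓ elems unique (complete t)))

module Transport (a b a′ b′ : ℕ) .{{_ : NonZero a}} .{{_ : NonZero b}} .{{_ : NonZero a′}} .{{_ : NonZero b′}}
                 (same-size : a * (2 * b) ≡ a′ * (2 * b′)) where
  private
    module S = Grp a b
    module T = Grp a′ b′

  transport : (Φ : S.Γ → T.Γ) → Injective _≡_ _≡_ Φ → (∀ u v → Φ (u S.-Γ v) ≡ Φ u T.-Γ Φ v) → Φ (t a b) ≡ t a′ b′ →
              ∀ {P} → NearOrthomorphism a b P → NearOrthomorphism a′ b′ (Φ P)
  transport Φ Φ-inj Φ-hom Φ-t {P} N = record
    { ψ              = ψ′
    ; injective      = λ e → Φ⁻¹-inj (injective (Φ-inj e))
    ; fixes-0        = trans (cong (Φ ∘ ψ) Φ⁻¹-0) (trans (cong Φ fixes-0) Φ-0)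
    ; fixes-P        = trans (cong (Φ ∘ ψ) (Φ⁻¹∘Φ P)) (cong Φ fixes-P)
    ; P≢0            = λ e → P≢0 (Φ-inj (trans e (sym Φ-0)))
    ; diff-injective = λ u v u≢ v≢ e → Φ⁻¹-inj (diff-injective (Φ⁻¹ u) (Φ⁻¹ v) (avoid u≢) (avoid v≢)
                                         (Φ-inj (trans (sym (diff u)) (trans e (diff v)))))
    ; diff≢t         = λ u u≢ e → diff≢t (Φ⁻¹ u) (avoid u≢) (Φ-inj (trans (sym (diff u)) (trans e (sym Φ-t))))
    }
    where
    open NearOrthomorphism N
    iso : S.Γ ↔ T.Γ
    iso = injective⇒↔ (enumeration a b) (enumeration a′ b′) Φ Φ-inj
            (trans (length-Fin×Fin a (2 * b)) (trans same-size (sym (length-Fin×Fin a′ (2 * b′)))))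
    Φ⁻¹ : T.Γ → S.Γ
    Φ⁻¹ = Inverse.from iso
    Φ∘Φ⁻¹ : ∀ u → Φ (Φ⁻¹ u) ≡ u
    Φ∘Φ⁻¹ = Inverse.strictlyInverseˡ iso
    Φ⁻¹∘Φ : ∀ u → Φ⁻¹ (Φ u) ≡ u
    Φ⁻¹∘Φ = Inverse.strictlyInverseʳ iso
    Φ⁻¹-inj : ∀ {u v} → Φ⁻¹ u ≡ Φ⁻¹ v → u ≡ v
    Φ⁻¹-inj {u} {v} e = trans (sym (Φ∘Φ⁻¹ u)) (trans (cong Φ e) (Φ∘Φ⁻¹ v))
    ψ′ : T.Γ → T.Γ
    ψ′ u = Φ (ψ (Φ⁻¹ u))
    Φ-0 : Φ S.zeroΓ ≡ T.zeroΓ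
    Φ-0 = trans (cong Φ (sym (-Γ-self a b S.zeroΓ))) (trans (Φ-hom S.zeroΓ S.zeroΓ) (-Γ-self a′ b′ (Φ S.zeroΓ)))
    Φ⁻¹-0 : Φ⁻¹ T.zeroΓ ≡ S.zeroΓ
    Φ⁻¹-0 = trans (cong Φ⁻¹ (sym Φ-0)) (Φ⁻¹∘Φ S.zeroΓ)
    diff : ∀ u → ψ′ u T.-Γ u ≡ Φ (ψ (Φ⁻¹ u) S.-Γ Φ⁻¹ u)
    diff u = trans (cong (ψ′ u T.-Γ_) (sym (Φ∘Φ⁻¹ u))) (sym (Φ-hom (ψ (Φ⁻¹ u)) (Φ⁻¹ u)))
    avoid : ∀ {u} → ¬ u ≡ Φ P → ¬ Φ⁻¹ u ≡ P
    avoid {u} u≢ e = u≢ (trans (sym (Φ∘Φ⁻¹ u)) (cong Φ e))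

module Negation (a b : ℕ) .{{_ : NonZero a}} .{{_ : NonZero b}} where
  open Grp a b

  private
    negΓ-t : negΓ (t a b) ≡ t a b
    negΓ-t = cong₂ _,_ (neg-ι {x = 0} {y = 0} mod-refl)
                       (neg-ι {x = b} {y = b} (subst (_≡ 0 [mod 2 * b ]) (cong (b +_) (+-identityʳ b)) k≡0-mod))

  negation : ∀ {P} → NearOrthomorphism a b P → NearOrthomorphism a b (negΓ P)
  negation = Transport.transport a b a b refl negΓ
    (λ e → cong₂ _,_ (neg-injective (cong proj₁ e)) (neg-injective (cong proj₂ e)))
    (λ (x , y) (x′ , y′) → cong₂ _,_ (neg-sub x x′) (neg-sub y y′))
    negΓ-t

module Swap (a b ja jb ν ν′ : ℕ) .{{_ : NonZero a}} .{{_ : NonZero b}}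
            (a-odd : a ≡ 1 + 2 * ja) (b-odd : b ≡ 1 + 2 * jb)
            (ν-odd : ν ≡ 1 [mod 2 ]) (ν-unit : ν′ * ν ≡ 1 [mod 2 * a ]) where
  private
    module S = Grp a b
    module T = Grp b a

    combine : ℕ → ℕ → ℕ
    combine w r = ν * (2 * w + r * a)

    combine-cong : ∀ {w w′ r r′} → w ≡ w′ [mod a ] → r ≡ r′ [mod 2 ] → combine w r ≡ combine w′ r′ [mod 2 * a ]
    combine-cong w≡w′ r≡r′ = *-congˡ-mod ν (+-cong-mod (*-scale-mod 2 w≡w′) (*-scaleʳ-mod a r≡r′))

    combine-+ : ∀ w r w′ r′ → ν * (2 * w + r * a) + ν * (2 * w′ + r′ * a) ≡ ν * (2 * (w + w′) + (r + r′) * a)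
    combine-+ w r w′ r′ = solve (w ∷ r ∷ w′ ∷ r′ ∷ ν ∷ a ∷ [])

    combine≡-mod2 : ∀ w r → 2 * w + r * a ≡ r [mod 2 ]
    combine≡-mod2 w r = +-cong-mod (subst (_≡ 0 [mod 2 ]) (*-comm w 2) (*k≡0-mod w)) (*-odd≡-mod2 ja a-odd r)

  -- For odd a and b both groups are cyclic of order 2ab; Φ is such an isomorphism, scaled by the unit ν.
  Φ : S.Γ → T.Γ
  Φ (w , r) = ι b (toℕ r) , ι (2 * a) (combine (toℕ w) (toℕ r))

  private
    Φ-hom : ∀ u v → Φ (u S.-Γ v) ≡ Φ u T.-Γ Φ v
    Φ-hom (w , r) (w′ , r′) = cong₂ _,_ (sub-unique first) (sub-unique second)
      where
      sw sr : ℕ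
      sw = toℕ (Cyclic.sub a w w′)
      sr = toℕ (Cyclic.sub (2 * b) r r′)
      r≡-mod2b : sr + toℕ r′ ≡ toℕ r [mod 2 * b ]
      r≡-mod2b = sub-mod r r′
      first : toℕ (ι b sr) + toℕ (ι b (toℕ r′)) ≡ toℕ (ι b (toℕ r)) [mod b ]
      first = begin
        toℕ (ι b sr) + toℕ (ι b (toℕ r′))   ≈⟨ +-cong-mod (toℕ-ι-mod sr) (toℕ-ι-mod (toℕ r′)) ⟩
        sr + toℕ r′                         ≈⟨ mod-∣ (n∣m*n 2) r≡-mod2b ⟩
        toℕ r                               ≈⟨ toℕ-ι-mod (toℕ r) ⟨
        toℕ (ι b (toℕ r))                   ∎
        where open mod-Reasoning b
      second : toℕ (ι (2 * a) (combine sw sr)) + toℕ (ι (2 * a) (combine (toℕ w′) (toℕ r′)))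
               ≡ toℕ (ι (2 * a) (combine (toℕ w) (toℕ r))) [mod 2 * a ]
      second = begin
        toℕ (ι (2 * a) (combine sw sr)) + toℕ (ι (2 * a) (combine (toℕ w′) (toℕ r′)))
          ≈⟨ +-cong-mod (toℕ-ι-mod _) (toℕ-ι-mod _) ⟩
        combine sw sr + combine (toℕ w′) (toℕ r′)
          ≡⟨ combine-+ sw sr (toℕ w′) (toℕ r′) ⟩
        combine (sw + toℕ w′) (sr + toℕ r′)
          ≈⟨ combine-cong (sub-mod w w′) (mod-∣ (m∣m*n b) r≡-mod2b) ⟩
        combine (toℕ w) (toℕ r)
          ≈⟨ toℕ-ι-mod _ ⟨
        toℕ (ι (2 * a) (combine (toℕ w) (toℕ r))) ∎
        where open mod-Reasoning (2 * a)

    Φ-injective : ∀ {u v} → Φ u ≡ Φ v → u ≡ v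
    Φ-injective {w , r} {w′ , r′} e = cong₂ _,_ w≡w′ r≡r′
      where
      r≡r′-mod-b : toℕ r ≡ toℕ r′ [mod b ]
      r≡r′-mod-b = ι-injective-mod (cong proj₁ e)
      combine≡ : 2 * toℕ w + toℕ r * a ≡ 2 * toℕ w′ + toℕ r′ * a [mod 2 * a ]
      combine≡ = *-cancelˡ-mod-unit ν ν′ ν-unit (ι-injective-mod (cong proj₂ e))
      r≡r′-mod-2 : toℕ r ≡ toℕ r′ [mod 2 ]
      r≡r′-mod-2 = mod-trans (mod-sym (combine≡-mod2 (toℕ w) (toℕ r)))
                     (mod-trans (mod-∣ (m∣m*n a) combine≡) (combine≡-mod2 (toℕ w′) (toℕ r′)))
      r≡r′ : r ≡ r′
      r≡r′ = toℕ-injective-mod (mod-odd∧mod2⇒mod2*odd jb b-odd r≡r′-mod-b r≡r′-mod-2)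
      w≡w′ : w ≡ w′
      w≡w′ = toℕ-injective-mod (*-cancelˡ-scaled-mod 2 (+-cancelʳ-mod (toℕ r * a)
               (subst (λ z → 2 * toℕ w + toℕ r * a ≡ 2 * toℕ w′ + toℕ z * a [mod 2 * a ]) (sym r≡r′) combine≡)))

    Φ-t : Φ (t a b) ≡ t b a
    Φ-t = cong₂ _,_ (ι-cong (mod-trans (mod-∣ (n∣m*n 2) (toℕ-ι-mod b)) k≡0-mod)) (ι-cong (begin
      combine (toℕ (ι a 0)) (toℕ (ι (2 * b) b))   ≈⟨ combine-cong (toℕ-ι-mod 0) (mod-∣ (m∣m*n b) (toℕ-ι-mod b)) ⟩
      combine 0 b                                 ≡⟨ *-assoc ν b a ⟨
      (ν * b) * a                                 ≈⟨ *-scaleʳ-mod a νb≡1 ⟩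
      1 * a                                       ≡⟨ *-identityˡ a ⟩
      a                                           ∎))
      where
      open mod-Reasoning (2 * a)
      νb≡1 : ν * b ≡ 1 [mod 2 ]
      νb≡1 = mod-trans (*-odd≡-mod2 jb b-odd ν) ν-odd

  swap : ∀ {P} → NearOrthomorphism a b P → NearOrthomorphism b a (Φ P)
  swap = Transport.transport a b b a (solve (a ∷ b ∷ [])) Φ Φ-injective Φ-hom Φ-t

  swap-embed : ∀ w r → Φ (S.embed w r) ≡ T.embed r (ν * (2 * w + r * a))
  swap-embed w r = embed-cong b a (mod-∣ (n∣m*n 2) (toℕ-ι-mod r)) (combine-cong (toℕ-ι-mod w) (mod-∣ (m∣m*n b) (toℕ-ι-mod r)))

module Reflection (N c : ℕ) .{{_ : NonZero N}} (c-half : 2 * c ≡ N + 1 ⊎ 2 * c ≡ N) where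

  -- reflect fixes 0 and reflects the blocks [1, 2c) and [2c, 2N) onto themselves. Its differences are
  -- 2c - 2y on the lower and 2c - 1 - 2y on the upper block: they differ in parity across the blocks,
  -- and within a block they determine y because a block is no longer than N.
  reflect : ℕ → ℕ
  reflect zero = zero
  reflect y@(suc _) with y <? 2 * c
  ... | yes _ = 2 * c ∸ y
  ... | no _  = 2 * c + 2 * N ∸ suc y

  private
    0<N : 0 < N
    0<N = >-nonZero⁻¹ N

    N≤2c : N ≤ 2 * c
    N≤2c = [ (λ e → ≤-trans (m≤m+n N 1) (≤-reflexive (sym e))) , (λ e → ≤-reflexive (sym e)) ]′ c-half

    2c≤1+N : 2 * c ≤ 1 + N
    2c≤1+N = [ (λ e → ≤-reflexive (trans e (+-comm N 1))) , (λ e → ≤-trans (≤-reflexive e) (n≤1+n N)) ]′ c-half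

    1≤c : 1 ≤ c
    1≤c = positive N≤2c
      where
      positive : ∀ {d} → N ≤ 2 * d → 1 ≤ d
      positive {zero}  N≤0 = ≤-trans 0<N N≤0
      positive {suc _} _   = s≤s z≤n

    N+N≡2N : N + N ≡ 2 * N
    N+N≡2N = cong (N +_) (sym (+-identityʳ N))

    c<2c : c < 2 * c
    c<2c = subst (c <_) (cong (c +_) (sym (+-identityʳ c))) (m<m+n c 1≤c)

    2c≤2N : 2 * c ≤ 2 * N
    2c≤2N = ≤-trans 2c≤1+N (≤-trans (+-monoˡ-≤ N 0<N) (≤-reflexive N+N≡2N))

  data Block : ℕ → Set where
    origin : Block 0
    lower  : ∀ {y} → 1 ≤ y → y < 2 * c → Block y
    upper  : ∀ {y} → 2 * c ≤ y → Block y

  block : ∀ y → Block y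
  block zero = origin
  block y@(suc _) with y <? 2 * c
  ... | yes y<2c = lower (s≤s z≤n) y<2c
  ... | no y≮2c  = upper (≮⇒≥ y≮2c)

  reflect-lower : ∀ {y} → 1 ≤ y → y < 2 * c → reflect y + y ≡ 2 * c
  reflect-lower {y@(suc _)} _ y<2c with y <? 2 * c
  ... | yes _    = m∸n+n≡m (<⇒≤ y<2c)
  ... | no y≮2c  = contradiction y<2c y≮2c

  reflect-upper : ∀ {y} → 2 * c ≤ y → y < 2 * N → suc (reflect y + y) ≡ 2 * c + 2 * N
  reflect-upper {zero} 2c≤0 _ = contradiction 2c≤0 (<⇒≱ (≤-<-trans z≤n c<2c))
  reflect-upper {y@(suc _)} 2c≤y y<2N with y <? 2 * c
  ... | yes y<2c = contradiction 2c≤y (<⇒≱ y<2c)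
  ... | no _     = trans (sym (+-suc (2 * c + 2 * N ∸ suc y) y))
                         (m∸n+n≡m (≤-trans y<2N (m≤n+m (2 * N) (2 * c))))

  reflect-lower-range : ∀ {y} → 1 ≤ y → y < 2 * c → 1 ≤ reflect y × reflect y < 2 * c
  reflect-lower-range {y} 1≤y y<2c =
      +-cancelʳ-< y 0 (reflect y) (subst (y <_) (sym (reflect-lower 1≤y y<2c)) y<2c)
    , subst₂ _<_ (+-identityʳ (reflect y)) (reflect-lower 1≤y y<2c) (+-monoʳ-< (reflect y) 1≤y)

  reflect-upper-range : ∀ {y} → 2 * c ≤ y → y < 2 * N → 2 * c ≤ reflect y × reflect y < 2 * N
  reflect-upper-range {y} 2c≤y y<2N =
      +-cancelʳ-≤ y (2 * c) (reflect y) (≤-pred (subst (2 * c + y <_) (sym eq) (+-monoʳ-< (2 * c) y<2N)))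
    , +-cancelʳ-< (2 * c) (reflect y) (2 * N) (begin-strict
        reflect y + 2 * c       ≤⟨ +-monoʳ-≤ (reflect y) 2c≤y ⟩
        reflect y + y           <⟨ n<1+n _ ⟩
        suc (reflect y + y)     ≡⟨ eq ⟩
        2 * c + 2 * N           ≡⟨ +-comm (2 * c) (2 * N) ⟩
        2 * N + 2 * c           ∎)
    where
    open ≤-Reasoning
    eq : suc (reflect y + y) ≡ 2 * c + 2 * N
    eq = reflect-upper 2c≤y y<2N

  reflect-< : ∀ {y} → y < 2 * N → reflect y < 2 * N
  reflect-< {y} y<2N with block y
  ... | origin        = y<2N
  ... | lower 1≤y y<2c = <-≤-trans (proj₂ (reflect-lower-range 1≤y y<2c)) 2c≤2N
  ... | upper 2c≤y     = proj₂ (reflect-upper-range 2c≤y y<2N)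

  reflect-involutive : ∀ {y} → y < 2 * N → reflect (reflect y) ≡ y
  reflect-involutive {y} y<2N with block y
  ... | origin = refl
  ... | lower 1≤y y<2c = +-cancelʳ-≡ (reflect y) _ _ (begin
          reflect (reflect y) + reflect y   ≡⟨ reflect-lower r-lo r-hi ⟩
          2 * c                             ≡⟨ reflect-lower 1≤y y<2c ⟨
          reflect y + y                     ≡⟨ +-comm (reflect y) y ⟩
          y + reflect y                     ∎)
    where
    open ≡-Reasoning
    r-lo : 1 ≤ reflect y
    r-lo = proj₁ (reflect-lower-range 1≤y y<2c)
    r-hi : reflect y < 2 * c
    r-hi = proj₂ (reflect-lower-range 1≤y y<2c)
  ... | upper 2c≤y = +-cancelʳ-≡ (reflect y) _ _ (suc-injective (begin
          suc (reflect (reflect y) + reflect y)   ≡⟨ reflect-upper r-lo r-hi ⟩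
          2 * c + 2 * N                           ≡⟨ reflect-upper 2c≤y y<2N ⟨
          suc (reflect y + y)                     ≡⟨ cong suc (+-comm (reflect y) y) ⟩
          suc (y + reflect y)                     ∎))
    where
    open ≡-Reasoning
    r-lo : 2 * c ≤ reflect y
    r-lo = proj₁ (reflect-upper-range 2c≤y y<2N)
    r-hi : reflect y < 2 * N
    r-hi = proj₂ (reflect-upper-range 2c≤y y<2N)

  reflect-c : reflect c ≡ c
  reflect-c = +-cancelʳ-≡ c _ _ (trans (reflect-lower 1≤c c<2c) (cong (c +_) (+-identityʳ c)))

  private
    twice-window : ∀ s {y y′} → s ≤ y → y < s + N → s ≤ y′ → y′ < s + N → 2 * y ≡ 2 * y′ [mod 2 * N ] → y ≡ y′
    twice-window s s≤y y< s≤y′ y′< p = mod-window s s≤y y< s≤y′ y′< (*-cancelˡ-scaled-mod 2 p)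

    lower-window : ∀ {y} → y < 2 * c → y < 1 + N
    lower-window y<2c = <-≤-trans y<2c 2c≤1+N

    upper-window : ∀ {y} → y < 2 * N → y < 2 * c + N
    upper-window y<2N = <-≤-trans y<2N (≤-trans (≤-reflexive (sym N+N≡2N)) (+-monoˡ-≤ N N≤2c))

  SameDiff : ℕ → ℕ → Set
  SameDiff y y′ = reflect y + y′ ≡ reflect y′ + y [mod 2 * N ]

  private
    doubled : ∀ {y y′} → SameDiff y y′ → reflect y + y + 2 * y′ ≡ reflect y′ + y′ + 2 * y [mod 2 * N ]
    doubled {y} {y′} p = add-y+y′ (reflect y) (reflect y′) y y′ p
      where
      add-y+y′ : ∀ r r′ y y′ → r + y′ ≡ r′ + y [mod 2 * N ] → r + y + 2 * y′ ≡ r′ + y′ + 2 * y [mod 2 * N ]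
      add-y+y′ r r′ y y′ p = begin
        r + y + 2 * y′          ≡⟨ solve (r ∷ y ∷ y′ ∷ []) ⟩
        (r + y′) + (y + y′)     ≈⟨ +-congʳ-mod (y + y′) p ⟩
        (r′ + y) + (y + y′)     ≡⟨ solve (r′ ∷ y ∷ y′ ∷ []) ⟩
        r′ + y′ + 2 * y         ∎
        where open mod-Reasoning (2 * N)

    lower-lower : ∀ {y y′} → 1 ≤ y → y < 2 * c → 1 ≤ y′ → y′ < 2 * c → SameDiff y y′ → y ≡ y′
    lower-lower {y} {y′} 1≤y y<2c 1≤y′ y′<2c p = sym (twice-window 1 1≤y′ (lower-window y′<2c) 1≤y (lower-window y<2c)
      (+-cancelˡ-mod (2 * c) (subst₂ (λ u v → u + 2 * y′ ≡ v + 2 * y [mod 2 * N ])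
        (reflect-lower 1≤y y<2c) (reflect-lower 1≤y′ y′<2c) (doubled {y} {y′} p))))

    upper-upper : ∀ {y y′} → 2 * c ≤ y → y < 2 * N → 2 * c ≤ y′ → y′ < 2 * N → SameDiff y y′ → y ≡ y′
    upper-upper {y} {y′} 2c≤y y<2N 2c≤y′ y′<2N p = sym (twice-window (2 * c) 2c≤y′ (upper-window y′<2N) 2c≤y (upper-window y<2N)
      (+-cancelˡ-mod (2 * c + 2 * N) (subst₂ (λ u v → u + 2 * y′ ≡ v + 2 * y [mod 2 * N ])
        (reflect-upper 2c≤y y<2N) (reflect-upper 2c≤y′ y′<2N) (+-congˡ-mod 1 (doubled {y} {y′} p)))))

    lower-upper : ∀ {y y′} → 1 ≤ y → y < 2 * c → 2 * c ≤ y′ → y′ < 2 * N → ¬ SameDiff y y′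
    lower-upper {y} {y′} 1≤y y<2c 2c≤y′ y′<2N p = odd≢even-mod (c + y′) (c + N + y) N (begin
      2 * (c + y′) + 1              ≡⟨ solve (c ∷ y′ ∷ []) ⟩
      1 + (2 * c + 2 * y′)          ≡⟨ cong (λ u → 1 + (u + 2 * y′)) (reflect-lower 1≤y y<2c) ⟨
      1 + (reflect y + y + 2 * y′)  ≈⟨ +-congˡ-mod 1 (doubled {y} {y′} p) ⟩
      suc (reflect y′ + y′) + 2 * y ≡⟨ cong (_+ 2 * y) (reflect-upper 2c≤y′ y′<2N) ⟩
      2 * c + 2 * N + 2 * y         ≡⟨ solve (c ∷ N ∷ y ∷ []) ⟩
      2 * (c + N + y)               ∎)
      where open mod-Reasoning (2 * N)

    origin-lower : ∀ {y′} → 1 ≤ y′ → y′ < 2 * c → SameDiff 0 y′ → y′ ≡ c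
    origin-lower {y′} 1≤y′ y′<2c p = twice-window 1 1≤y′ (lower-window y′<2c) 1≤c (lower-window c<2c) (begin
      2 * y′                  ≈⟨ doubled {0} {y′} p ⟩
      reflect y′ + y′ + 0     ≡⟨ +-identityʳ _ ⟩
      reflect y′ + y′         ≡⟨ reflect-lower 1≤y′ y′<2c ⟩
      2 * c                   ∎)
      where open mod-Reasoning (2 * N)

    origin-upper : ∀ {y′} → 2 * c ≤ y′ → y′ < 2 * N → ¬ SameDiff 0 y′
    origin-upper {y′} 2c≤y′ y′<2N p = odd≢even-mod y′ (c + N) N (begin
      2 * y′ + 1              ≡⟨ +-comm (2 * y′) 1 ⟩
      1 + 2 * y′              ≈⟨ +-congˡ-mod 1 (doubled {0} {y′} p) ⟩
      suc (reflect y′ + y′) + 0 ≡⟨ +-identityʳ _ ⟩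
      suc (reflect y′ + y′)   ≡⟨ reflect-upper 2c≤y′ y′<2N ⟩
      2 * c + 2 * N           ≡⟨ solve (c ∷ N ∷ []) ⟩
      2 * (c + N)             ∎)
      where open mod-Reasoning (2 * N)

  sameDiff⇒≡ : ∀ {y y′} → y < 2 * N → y′ < 2 * N → y ≢ c → y′ ≢ c → SameDiff y y′ → y ≡ y′
  sameDiff⇒≡ {y} {y′} y<2N y′<2N y≢c y′≢c p with block y | block y′
  ... | origin         | origin           = refl
  ... | origin         | lower 1≤y′ y′<2c = contradiction (origin-lower 1≤y′ y′<2c p) y′≢c
  ... | origin         | upper 2c≤y′      = contradiction p (origin-upper 2c≤y′ y′<2N)
  ... | lower 1≤y y<2c | origin           = contradiction (origin-lower 1≤y y<2c (mod-sym p)) y≢c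
  ... | lower 1≤y y<2c | lower 1≤y′ y′<2c = lower-lower 1≤y y<2c 1≤y′ y′<2c p
  ... | lower 1≤y y<2c | upper 2c≤y′      = contradiction p (lower-upper 1≤y y<2c 2c≤y′ y′<2N)
  ... | upper 2c≤y     | origin           = contradiction (mod-sym p) (origin-upper 2c≤y y<2N)
  ... | upper 2c≤y     | lower 1≤y′ y′<2c = contradiction (mod-sym p) (lower-upper 1≤y′ y′<2c 2c≤y y<2N)
  ... | upper 2c≤y     | upper 2c≤y′      = upper-upper 2c≤y y<2N 2c≤y′ y′<2N p

  private
    lower-avoids-N : ∀ {y} → 1 ≤ y → y < 2 * c → ¬ N + y ≡ reflect y [mod 2 * N ]
    lower-avoids-N {y} 1≤y y<2c p = [ 2c-odd , 2c-even ]′ c-half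
      where
      open mod-Reasoning (2 * N)
      key : N + 2 * y ≡ 2 * c [mod 2 * N ]
      key = begin
        N + 2 * y       ≡⟨ solve (N ∷ y ∷ []) ⟩
        N + y + y       ≈⟨ +-congʳ-mod y p ⟩
        reflect y + y   ≡⟨ reflect-lower 1≤y y<2c ⟩
        2 * c           ∎
      2c-odd : ¬ 2 * c ≡ N + 1
      2c-odd e = odd≢even-mod 0 y N (mod-sym (+-cancelˡ-mod N (mod-trans key (mod-reflexive e))))
      2c-even : ¬ 2 * c ≡ N
      2c-even e = <⇒≢ (<-≤-trans y<2c (≤-reflexive e))
        (twice-window 1 1≤y (lower-window y<2c) 0<N (n<1+n N) (+-cancelˡ-mod N (begin
          N + 2 * y       ≈⟨ key ⟩
          2 * c           ≡⟨ e ⟩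
          N               ≡⟨ +-identityʳ N ⟨
          N + 0           ≈⟨ +-congˡ-mod N k≡0-mod ⟨
          N + 2 * N       ∎)))

    upper-avoids-N : ∀ {y} → 2 * c ≤ y → y < 2 * N → ¬ N + y ≡ reflect y [mod 2 * N ]
    upper-avoids-N {y} 2c≤y y<2N p = [ 2c-odd , 2c-even ]′ c-half
      where
      open mod-Reasoning (2 * N)
      key : N + (2 * y + 1) ≡ 2 * c + 2 * N [mod 2 * N ]
      key = begin
        N + (2 * y + 1)       ≡⟨ solve (N ∷ y ∷ []) ⟩
        1 + (N + y + y)       ≈⟨ +-congˡ-mod 1 (+-congʳ-mod y p) ⟩
        suc (reflect y + y)   ≡⟨ reflect-upper 2c≤y y<2N ⟩
        2 * c + 2 * N         ∎
      2c-odd : ¬ 2 * c ≡ N + 1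
      2c-odd e = <⇒≢ y<2N (twice-window (2 * c) 2c≤y (upper-window y<2N) 2c≤2N 2N<2c+N (begin
        2 * y           ≈⟨ +-cancelˡ-mod (N + 1) (begin
                             N + 1 + 2 * y       ≡⟨ solve (N ∷ y ∷ []) ⟩
                             N + (2 * y + 1)     ≈⟨ key ⟩
                             2 * c + 2 * N       ≡⟨ cong (_+ 2 * N) e ⟩
                             N + 1 + 2 * N       ∎) ⟩
        2 * N           ≈⟨ k≡0-mod ⟩
        0               ≈⟨ *k≡0-mod 2 ⟨
        2 * (2 * N)     ∎))
        where
        2N<2c+N : 2 * N < 2 * c + N
        2N<2c+N = ≤-<-trans (≤-reflexive (sym N+N≡2N))
                    (subst (N + N <_) (cong (_+ N) (trans (+-comm 1 N) (sym e))) (+-monoˡ-< N (n<1+n N)))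
      2c-even : ¬ 2 * c ≡ N
      2c-even e = odd≢even-mod y N N (+-cancelˡ-mod N (begin
        N + (2 * y + 1)   ≈⟨ key ⟩
        2 * c + 2 * N     ≡⟨ cong (_+ 2 * N) e ⟩
        N + 2 * N         ∎))

  avoids-N : ∀ {y} → y < 2 * N → ¬ N + y ≡ reflect y [mod 2 * N ]
  avoids-N {y} y<2N p with block y
  ... | origin         = n≢0-mod2n N (mod-trans (mod-reflexive (sym (+-identityʳ N))) p)
  ... | lower 1≤y y<2c = lower-avoids-N 1≤y y<2c p
  ... | upper 2c≤y     = upper-avoids-N 2c≤y y<2N p

  open Grp 1 N

  θ : Fin (2 * N) → Fin (2 * N)
  θ y = ι (2 * N) (reflect (toℕ y))

  toℕ-θ : ∀ y → toℕ (θ y) ≡ reflect (toℕ y)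
  toℕ-θ y = toℕ-ι-< (reflect-< (toℕ<n y))

  θ-injective : ∀ {y y′} → θ y ≡ θ y′ → y ≡ y′
  θ-injective {y} {y′} e = toℕ-injective (begin
    toℕ y                       ≡⟨ reflect-involutive (toℕ<n y) ⟨
    reflect (reflect (toℕ y))   ≡⟨ cong reflect (trans (sym (toℕ-θ y)) (trans (cong toℕ e) (toℕ-θ y′))) ⟩
    reflect (reflect (toℕ y′))  ≡⟨ reflect-involutive (toℕ<n y′) ⟩
    toℕ y′                      ∎)
    where open ≡-Reasoning

  toℕ-c : toℕ (ι (2 * N) c) ≡ c
  toℕ-c = toℕ-ι-< (<-≤-trans c<2c 2c≤2N)

  reflection : NearOrthomorphism 1 N (embed 0 c)
  reflection = record
    { ψ              = λ (z , y) → z , θ y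
    ; injective      = λ e → cong₂ _,_ (cong proj₁ e) (θ-injective (cong proj₂ e))
    ; fixes-0        = cong (λ v → ι 1 0 , ι (2 * N) (reflect v)) (toℕ-ι-0 {2 * N})
    ; fixes-P        = cong (λ v → ι 1 0 , ι (2 * N) v) (trans (cong reflect toℕ-c) reflect-c)
    ; P≢0            = λ e → <⇒≢ 1≤c (sym (trans (sym toℕ-c) (trans (cong (λ u → toℕ (proj₂ u)) e) toℕ-ι-0)))
    ; diff-injective = λ (z , y) (z′ , y′) u≢P v≢P e → cong₂ _,_ (Fin1-irrelevant z z′)
                         (toℕ-injective (sameDiff⇒≡ (toℕ<n y) (toℕ<n y′) (≢c u≢P) (≢c v≢P) (sameDiff y y′ (cong proj₂ e))))
    ; diff≢t         = λ (z , y) _ e → avoids-N (toℕ<n y) (begin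
                         N + toℕ y                          ≈⟨ +-congʳ-mod (toℕ y) (ι≡⇒toℕ-mod (cong proj₂ e)) ⟨
                         toℕ (Cyclic.sub (2 * N) (θ y) y) + toℕ y   ≈⟨ sub-mod (θ y) y ⟩
                         toℕ (θ y)                          ≡⟨ toℕ-θ y ⟩
                         reflect (toℕ y)                    ∎)
    }
    where
    open mod-Reasoning (2 * N)
    ≢c : ∀ {z y} → ¬ (z , y) ≡ embed 0 c → toℕ y ≢ c
    ≢c {z} u≢P y≡c = u≢P (cong₂ _,_ (Fin1-irrelevant z _) (toℕ-injective (trans y≡c (sym toℕ-c))))
    sameDiff : ∀ y y′ → Cyclic.sub (2 * N) (θ y) y ≡ Cyclic.sub (2 * N) (θ y′) y′ →
               SameDiff (toℕ y) (toℕ y′)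
    sameDiff y y′ e = subst₂ (λ u v → u + toℕ y′ ≡ v + toℕ y [mod 2 * N ]) (toℕ-θ y) (toℕ-θ y′) (sub≡sub⇒mod e)

module Indicator (m k : ℕ) .{{_ : NonZero m}} (m-odd : m ≡ 1 + 2 * k) where

  χ : ℕ → ℕ
  χ zero = 0
  χ v@(suc _) with v ≤? k
  ... | yes _ = 1
  ... | no _  = 0

  χ≤1 : ∀ v → χ v ≤ 1
  χ≤1 zero = z≤n
  χ≤1 v@(suc _) with v ≤? k
  ... | yes _ = s≤s z≤n
  ... | no _  = z≤n

  χ-in : ∀ {v} → 1 ≤ v → v ≤ k → χ v ≡ 1
  χ-in {v@(suc _)} _ v≤k with v ≤? k
  ... | yes _   = refl
  ... | no v≰k  = contradiction v≤k v≰k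

  χ-out : ∀ {v} → k < v → χ v ≡ 0
  χ-out {v@(suc _)} k<v with v ≤? k
  ... | yes v≤k = contradiction v≤k (<⇒≱ k<v)
  ... | no _    = refl

  private
    k+suc-k≡m : k + suc k ≡ m
    k+suc-k≡m = trans (+-suc k k) (trans (cong (λ j → suc (k + j)) (sym (+-identityʳ k))) (sym m-odd))

    k<m : k < m
    k<m = subst (k <_) k+suc-k≡m (m<m+n k (s≤s z≤n))

  χ-flip : ∀ {U V} → U < m → V < m → U + suc k ≡ V [mod m ] → χ U ≡ χ V → U ≡ 0
  χ-flip {zero} _ _ _ _ = refl
  χ-flip {U@(suc _)} {V} U<m V<m U+1+k≡V same with U ≤? k
  ... | yes U≤k = contradiction (trans same χV≡0) 1+n≢0
    where
    W≤m : U + suc k ≤ m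
    W≤m = subst (U + suc k ≤_) k+suc-k≡m (+-monoˡ-≤ (suc k) U≤k)
    χV≡0 : χ V ≡ 0
    χV≡0 with m≤n⇒m<n∨m≡n W≤m
    ... | inj₁ W<m = trans (cong χ (sym (mod-<⇒≡ U+1+k≡V W<m V<m))) (χ-out (m≤n+m (suc k) U))
    ... | inj₂ W≡m = cong χ (mod-<⇒≡ (mod-trans (mod-sym U+1+k≡V) (mod-trans (mod-reflexive W≡m) k≡0-mod)) V<m (>-nonZero⁻¹ m))
  ... | no U≰k with m≤n⇒∃[o]m+o≡n (≰⇒> U≰k)
  ...   | w , suc-k+w≡U = contradiction (trans same (trans (cong χ V≡suc-w) (χ-in (s≤s z≤n) w<k))) 0≢1+n
    where
    w<k : w < k
    w<k = +-cancelˡ-< (suc k) w k (subst₂ _<_ (sym suc-k+w≡U) (trans (sym k+suc-k≡m) (+-comm k (suc k))) U<m)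
    V≡suc-w : V ≡ suc w
    V≡suc-w = mod-<⇒≡ (begin
      V                     ≈⟨ U+1+k≡V ⟨
      U + suc k             ≡⟨ cong (_+ suc k) suc-k+w≡U ⟨
      suc k + w + suc k     ≡⟨ solve (k ∷ w ∷ []) ⟩
      suc w + (k + suc k)   ≡⟨ cong (suc w +_) k+suc-k≡m ⟩
      suc w + m             ≈⟨ +-congˡ-mod (suc w) k≡0-mod ⟩
      suc w + 0             ≡⟨ +-identityʳ (suc w) ⟩
      suc w                 ∎) V<m (≤-<-trans w<k k<m)
      where open mod-Reasoning m

  χ-ι-suc-k : χ (toℕ (ι m (suc k))) ≡ 0
  χ-ι-suc-k with m≤n⇒m<n∨m≡n k<m
  ... | inj₁ suc-k<m = trans (cong χ (toℕ-ι-< suc-k<m)) (χ-out (n<1+n k))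
  ... | inj₂ suc-k≡m = trans (cong (λ x → χ (toℕ x)) (ι-cong (mod-trans (mod-reflexive suc-k≡m) k≡0-mod)))
                             (cong χ (toℕ-ι-0 {m}))

module CyclicPart (n : ℕ) .{{_ : NonZero n}} {z : Fin 1} {p : Fin (2 * n)}
                (N : NearOrthomorphism 1 n (z , p)) where
  open Grp 1 n
  open NearOrthomorphism N
  open Cyclic (2 * n) using (sub)

  θ : Fin (2 * n) → Fin (2 * n)
  θ y = proj₂ (ψ (z , y))

  ψ-on : ∀ x y → ψ (x , y) ≡ (x , θ y)
  ψ-on x y = cong₂ _,_ (Fin1-irrelevant _ x) (cong (λ x′ → proj₂ (ψ (x′ , y))) (Fin1-irrelevant x z))

  θ-injective : ∀ {y y′} → θ y ≡ θ y′ → y ≡ y′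
  θ-injective {y} {y′} e = cong proj₂ (injective (trans (ψ-on z y) (trans (cong (z ,_) e) (sym (ψ-on z y′)))))

  θ-0 : θ (ι (2 * n) 0) ≡ ι (2 * n) 0
  θ-0 = cong proj₂ (trans (sym (ψ-on _ _)) fixes-0)

  θ-p : θ p ≡ p
  θ-p = cong proj₂ fixes-P

  p≢0 : p ≢ ι (2 * n) 0
  p≢0 e = P≢0 (cong₂ _,_ (Fin1-irrelevant z _) e)

  e : Fin (2 * n) → Fin (2 * n)
  e y = sub (θ y) y

  private
    ψ-diff : ∀ y → ψ (z , y) -Γ (z , y) ≡ (Cyclic.sub 1 z z , e y)
    ψ-diff y = cong (_-Γ (z , y)) (ψ-on z y)

    ≢P : ∀ {y} → y ≢ p → (z , y) ≢ (z , p)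
    ≢P y≢p e = y≢p (cong proj₂ e)

  e-injective : ∀ {y y′} → y ≢ p → y′ ≢ p → e y ≡ e y′ → y ≡ y′
  e-injective {y} {y′} y≢p y′≢p eq = cong proj₂ (diff-injective (z , y) (z , y′) (≢P y≢p) (≢P y′≢p)
    (trans (ψ-diff y) (trans (cong (_ ,_) eq) (sym (ψ-diff y′)))))

  e≢n : ∀ {y} → y ≢ p → e y ≢ ι (2 * n) n
  e≢n {y} y≢p eq = diff≢t (z , y) (≢P y≢p) (trans (ψ-diff y) (cong₂ _,_ (Fin1-irrelevant _ _) eq))

  e-0 : e (ι (2 * n) 0) ≡ ι (2 * n) 0
  e-0 = trans (cong (λ w → sub w (ι (2 * n) 0)) θ-0) (sub-self _)

  e-p : e p ≡ ι (2 * n) 0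
  e-p = trans (cong (λ w → sub w p) θ-p) (sub-self p)

  e≢0 : ∀ {y} → y ≢ p → y ≢ ι (2 * n) 0 → e y ≢ ι (2 * n) 0
  e≢0 y≢p y≢0 eq = y≢0 (e-injective y≢p (λ 0≡p → p≢0 (sym 0≡p)) (trans eq (sym e-0)))

module Lifting (m n k : ℕ) .{{_ : NonZero m}} .{{_ : NonZero n}} (m-odd : m ≡ 1 + 2 * k)
               {z : Fin 1} {p : Fin (2 * n)} (N : NearOrthomorphism 1 n (z , p)) where
  open Indicator m k m-odd
  open CyclicPart n N
  open Grp m n
  open Cyclic using (sub)

  bump : Fin (2 * n) → ℕ
  bump y with y ≟ᶠ p
  ... | yes _ = k
  ... | no _  = 0

  bump-p : bump p ≡ k
  bump-p with p ≟ᶠ p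
  ... | yes _   = refl
  ... | no p≢p  = contradiction refl p≢p

  bump-≢ : ∀ {y} → y ≢ p → bump y ≡ 0
  bump-≢ {y} y≢p with y ≟ᶠ p
  ... | yes y≡p = contradiction y≡p y≢p
  ... | no _    = refl

  row : Fin m → Fin (2 * n) → Fin m
  row x y = ι m (2 * toℕ x + bump y)

  -- The difference of lifted at (x, y) is (x + bump y , e y + n * χ (row x y)). Doubling makes the first
  -- coordinate injective in x; the rows y = 0 and y = p, where e vanishes, would still collide, and the
  -- half turn n * χ separates them (χ-flip).
  lifted : Γ → Γ
  lifted (x , y) = row x y , ι (2 * n) (toℕ (θ y) + n * χ (toℕ (row x y)))

  x₀ : Fin m
  x₀ = ι m (suc k)

  private
    diff₁ : ∀ x y → toℕ (sub m (row x y) x) ≡ toℕ x + bump y [mod m ]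
    diff₁ x y = +-cancelʳ-mod (toℕ x) (begin
      toℕ (sub m (row x y) x) + toℕ x   ≈⟨ sub-mod (row x y) x ⟩
      toℕ (row x y)                     ≈⟨ toℕ-ι-mod _ ⟩
      2 * toℕ x + bump y                ≡⟨ regroup (toℕ x) (bump y) ⟩
      toℕ x + bump y + toℕ x            ∎)
      where
      open mod-Reasoning m
      regroup : ∀ a b → 2 * a + b ≡ a + b + a
      regroup = solve-∀

    diff₂ : ∀ x y → toℕ (sub (2 * n) (proj₂ (lifted (x , y))) y) ≡ toℕ (e y) + n * χ (toℕ (row x y)) [mod 2 * n ]
    diff₂ x y = +-cancelʳ-mod (toℕ y) (begin
      toℕ (sub (2 * n) (proj₂ (lifted (x , y))) y) + toℕ y   ≈⟨ sub-mod _ y ⟩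
      toℕ (proj₂ (lifted (x , y)))                          ≈⟨ toℕ-ι-mod _ ⟩
      toℕ (θ y) + h                                         ≈⟨ +-congʳ-mod h (sub-mod (θ y) y) ⟨
      toℕ (e y) + toℕ y + h                                 ≡⟨ xy∙z≈xz∙y (toℕ (e y)) (toℕ y) h ⟩
      toℕ (e y) + h + toℕ y                                 ∎)
      where
      open mod-Reasoning (2 * n)
      h : ℕ
      h = n * χ (toℕ (row x y))

    x+k≡0⇒x₀ : ∀ x → toℕ x + k ≡ 0 [mod m ] → x ≡ x₀
    x+k≡0⇒x₀ x x+k≡0 = toℕ-injective-mod (begin
      toℕ x                     ≡⟨ +-identityʳ (toℕ x) ⟨
      toℕ x + 0                 ≈⟨ +-congˡ-mod (toℕ x) k≡0-mod ⟨
      toℕ x + m                 ≡⟨ cong (toℕ x +_) m-odd ⟩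
      toℕ x + (1 + 2 * k)       ≡⟨ regroup (toℕ x) k ⟩
      toℕ x + k + suc k         ≈⟨ +-congʳ-mod (suc k) x+k≡0 ⟩
      suc k                     ≈⟨ toℕ-ι-mod (suc k) ⟨
      toℕ x₀                    ∎)
      where
      open mod-Reasoning m
      regroup : ∀ a k → a + (1 + 2 * k) ≡ a + k + suc k
      regroup = solve-∀

    row-x₀ : row x₀ p ≡ x₀
    row-x₀ = ι-cong (begin
      2 * toℕ x₀ + bump p       ≈⟨ +-cong-mod (*-congˡ-mod 2 (toℕ-ι-mod (suc k))) (mod-reflexive bump-p) ⟩
      2 * suc k + k             ≡⟨ regroup k ⟩
      suc k + (1 + 2 * k)       ≡⟨ cong (suc k +_) m-odd ⟨
      suc k + m                 ≈⟨ +-congˡ-mod (suc k) k≡0-mod ⟩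
      suc k + 0                 ≡⟨ +-identityʳ (suc k) ⟩
      suc k                     ∎)
      where
      open mod-Reasoning m
      regroup : ∀ k → 2 * suc k + k ≡ suc k + (1 + 2 * k)
      regroup = solve-∀

    0≢p : ι (2 * n) 0 ≢ p
    0≢p 0≡p = p≢0 (sym 0≡p)

    row-0 : row (ι m 0) (ι (2 * n) 0) ≡ ι m 0
    row-0 = cong (ι m) (cong₂ (λ a b → 2 * a + b) (toℕ-ι-0 {m}) (bump-≢ 0≢p))

  lifted-injective : ∀ {u v} → lifted u ≡ lifted v → u ≡ v
  lifted-injective {x , y} {x′ , y′} eq = cong₂ _,_ x≡x′ y≡y′
    where
    rows : row x y ≡ row x′ y′
    rows = cong proj₁ eq
    y≡y′ : y ≡ y′
    y≡y′ = θ-injective (toℕ-injective-mod (+-cancelʳ-mod (n * χ (toℕ (row x y)))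
             (subst (λ r → toℕ (θ y) + n * χ (toℕ (row x y)) ≡ toℕ (θ y′) + n * χ (toℕ r) [mod 2 * n ])
                    (sym rows) (ι-injective-mod (cong proj₂ eq)))))
    x≡x′ : x ≡ x′
    x≡x′ = toℕ-injective-mod (2*-cancelˡ-mod-odd k m-odd (+-cancelʳ-mod (bump y)
             (subst (λ w → 2 * toℕ x + bump y ≡ 2 * toℕ x′ + bump w [mod m ]) (sym y≡y′) (ι-injective-mod rows))))

  lifted-fixes-0 : lifted zeroΓ ≡ zeroΓ
  lifted-fixes-0 = cong₂ _,_ row-0 (cong (ι (2 * n)) (cong₂ _+_
    (trans (cong toℕ θ-0) (toℕ-ι-0 {2 * n}))
    (trans (cong (λ r → n * χ (toℕ r)) row-0) (trans (cong (λ v → n * χ v) (toℕ-ι-0 {m})) (*-zeroʳ n)))))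

  lifted-fixes-P : lifted (x₀ , p) ≡ (x₀ , p)
  lifted-fixes-P = cong₂ _,_ row-x₀ (begin
    ι (2 * n) (toℕ (θ p) + n * χ (toℕ (row x₀ p)))   ≡⟨ cong (λ r → ι (2 * n) (toℕ (θ p) + n * χ (toℕ r))) row-x₀ ⟩
    ι (2 * n) (toℕ (θ p) + n * χ (toℕ x₀))           ≡⟨ cong (λ c → ι (2 * n) (toℕ (θ p) + n * c)) χ-ι-suc-k ⟩
    ι (2 * n) (toℕ (θ p) + n * 0)                    ≡⟨ cong₂ (λ a b → ι (2 * n) (toℕ a + b)) θ-p (*-zeroʳ n) ⟩
    ι (2 * n) (toℕ p + 0)                            ≡⟨ cong (ι (2 * n)) (+-identityʳ (toℕ p)) ⟩
    ι (2 * n) (toℕ p)                                ≡⟨ ι-toℕ p ⟩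
    p                                                ∎)
    where open ≡-Reasoning

  lifted-diff≢t : ∀ u → u ≢ (x₀ , p) → lifted u -Γ u ≢ t m n
  lifted-diff≢t (x , y) u≢P eq = by-cases (y ≟ᶠ p)
    where
    open mod-Reasoning (2 * n)
    x+bump≡0 : toℕ x + bump y ≡ 0 [mod m ]
    x+bump≡0 = mod-trans (mod-sym (diff₁ x y)) (ι≡⇒toℕ-mod {x = 0} (cong proj₁ eq))
    by-cases : Dec (y ≡ p) → ⊥
    by-cases (yes y≡p) = u≢P (cong₂ _,_ (x+k≡0⇒x₀ x (subst (λ b → toℕ x + b ≡ 0 [mod m ]) (trans (cong bump y≡p) bump-p) x+bump≡0)) y≡p)
    by-cases (no y≢p)  = e≢n y≢p (toℕ-injective-mod (begin
      toℕ (e y)                              ≡⟨ +-identityʳ (toℕ (e y)) ⟨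
      toℕ (e y) + 0                          ≡⟨ cong (toℕ (e y) +_) (*-zeroʳ n) ⟨
      toℕ (e y) + n * 0                      ≡⟨ cong (λ c → toℕ (e y) + n * χ c) row≡0 ⟨
      toℕ (e y) + n * χ (toℕ (row x y))      ≈⟨ diff₂ x y ⟨
      toℕ (sub (2 * n) (proj₂ (lifted (x , y))) y) ≈⟨ ι≡⇒toℕ-mod {x = n} (cong proj₂ eq) ⟩
      n                                      ≈⟨ toℕ-ι-mod n ⟨
      toℕ (ι (2 * n) n)                      ∎))
      where
      x≡0 : toℕ x ≡ 0 [mod m ]
      x≡0 = subst₂ _≡_[mod m ] (trans (cong (toℕ x +_) (bump-≢ y≢p)) (+-identityʳ (toℕ x))) refl x+bump≡0
      row≡0 : toℕ (row x y) ≡ 0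
      row≡0 = mod-<⇒≡ (mod-trans (toℕ-ι-mod _) (+-cong-mod (*-congˡ-mod 2 x≡0) (mod-reflexive (bump-≢ y≢p))))
                (toℕ<n (row x y)) (>-nonZero⁻¹ m)

  private
    firsts : ∀ x y x′ y′ → lifted (x , y) -Γ (x , y) ≡ lifted (x′ , y′) -Γ (x′ , y′) →
             toℕ x + bump y ≡ toℕ x′ + bump y′ [mod m ]
    firsts x y x′ y′ eq = mod-trans (mod-sym (diff₁ x y)) (mod-trans (mod-reflexive (cong (λ d → toℕ (proj₁ d)) eq)) (diff₁ x′ y′))

    seconds : ∀ x y x′ y′ → lifted (x , y) -Γ (x , y) ≡ lifted (x′ , y′) -Γ (x′ , y′) →
              toℕ (e y) + n * χ (toℕ (row x y)) ≡ toℕ (e y′) + n * χ (toℕ (row x′ y′)) [mod 2 * n ]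
    seconds x y x′ y′ eq = mod-trans (mod-sym (diff₂ x y)) (mod-trans (mod-reflexive (cong (λ d → toℕ (proj₂ d)) eq)) (diff₂ x′ y′))

    mixed : ∀ x y x′ → y ≢ p → x′ ≢ x₀ → lifted (x , y) -Γ (x , y) ≢ lifted (x′ , p) -Γ (x′ , p)
    mixed x y x′ y≢p x′≢x₀ eq = by-cases (y ≟ᶠ ι (2 * n) 0)
      where
      U V : ℕ
      U = toℕ (row x y)
      V = toℕ (row x′ p)
      x≡x′+k : toℕ x ≡ toℕ x′ + k [mod m ]
      x≡x′+k = subst₂ _≡_[mod m ] (trans (cong (toℕ x +_) (bump-≢ y≢p)) (+-identityʳ (toℕ x))) (cong (toℕ x′ +_) bump-p)
                 (firsts x y x′ p eq)
      halves : toℕ (e y) + n * χ U ≡ n * χ V [mod 2 * n ]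
      halves = subst (λ a → toℕ (e y) + n * χ U ≡ a + n * χ V [mod 2 * n ]) (trans (cong toℕ e-p) (toℕ-ι-0 {2 * n}))
                 (seconds x y x′ p eq)
      by-cases : Dec (y ≡ ι (2 * n) 0) → ⊥
      by-cases (no y≢0) = [ (λ e≡0 → e≢0 y≢p y≢0 (toℕ-injective-mod (mod-trans e≡0 (mod-sym (toℕ-ι-mod 0)))))
                          , (λ e≡n → e≢n y≢p (toℕ-injective-mod (mod-trans e≡n (mod-sym (toℕ-ι-mod n))))) ]′
                          (E+n*b≡n*b′⇒E≡0∨n n (toℕ (e y)) (χ≤1 U) (χ≤1 V) halves)
      by-cases (yes y≡0) = x′≢x₀ (x+k≡0⇒x₀ x′ (mod-trans (mod-sym x≡x′+k) x≡0))
        where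
        open mod-Reasoning m
        χU≡χV : χ U ≡ χ V
        χU≡χV = n*b≡n*b′⇒b≡b′ n (χ≤1 U) (χ≤1 V)
                  (subst (λ a → a + n * χ U ≡ n * χ V [mod 2 * n ]) (trans (cong (λ w → toℕ (e w)) y≡0) (trans (cong toℕ e-0) (toℕ-ι-0 {2 * n}))) halves)
        U≡2x : U ≡ 2 * toℕ x [mod m ]
        U≡2x = mod-trans (toℕ-ι-mod _) (mod-reflexive (trans (cong (2 * toℕ x +_) (bump-≢ y≢p)) (+-identityʳ _)))
        U+1+k≡V : U + suc k ≡ V [mod m ]
        U+1+k≡V = begin
          U + suc k                         ≈⟨ +-congʳ-mod (suc k) (mod-trans U≡2x (*-congˡ-mod 2 x≡x′+k)) ⟩
          2 * (toℕ x′ + k) + suc k          ≡⟨ regroup (toℕ x′) k ⟩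
          2 * toℕ x′ + k + (1 + 2 * k)      ≡⟨ cong (2 * toℕ x′ + k +_) m-odd ⟨
          2 * toℕ x′ + k + m                ≈⟨ +-congˡ-mod (2 * toℕ x′ + k) k≡0-mod ⟩
          2 * toℕ x′ + k + 0                ≡⟨ +-identityʳ _ ⟩
          2 * toℕ x′ + k                    ≡⟨ cong (2 * toℕ x′ +_) bump-p ⟨
          2 * toℕ x′ + bump p               ≈⟨ toℕ-ι-mod _ ⟨
          V                                 ∎
          where
          regroup : ∀ a k → 2 * (a + k) + suc k ≡ 2 * a + k + (1 + 2 * k)
          regroup = solve-∀
        x≡0 : toℕ x ≡ 0 [mod m ]
        x≡0 = 2*-cancelˡ-mod-odd k m-odd (mod-trans (mod-sym U≡2x)
                (mod-reflexive (χ-flip (toℕ<n (row x y)) (toℕ<n (row x′ p)) U+1+k≡V χU≡χV)))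

  lifted-diff-injective : ∀ u v → u ≢ (x₀ , p) → v ≢ (x₀ , p) → lifted u -Γ u ≡ lifted v -Γ v → u ≡ v
  lifted-diff-injective (x , y) (x′ , y′) u≢P v≢P eq = by-cases (y ≟ᶠ p) (y′ ≟ᶠ p)
    where
    bumps : ∀ {b b′} → bump y ≡ b → bump y′ ≡ b′ → toℕ x + b ≡ toℕ x′ + b′ [mod m ]
    bumps refl refl = firsts x y x′ y′ eq
    by-cases : Dec (y ≡ p) → Dec (y′ ≡ p) → (x , y) ≡ (x′ , y′)
    by-cases (yes y≡p) (yes y′≡p) = cong₂ _,_
      (toℕ-injective-mod (+-cancelʳ-mod k (bumps (trans (cong bump y≡p) bump-p) (trans (cong bump y′≡p) bump-p))))
      (trans y≡p (sym y′≡p))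
    by-cases (no y≢p) (no y′≢p) = cong₂ _,_ x≡x′ (e-injective y≢p y′≢p (toℕ-injective-mod (+-cancelʳ-mod (n * χ (toℕ (row x y)))
      (subst (λ r → toℕ (e y) + n * χ (toℕ (row x y)) ≡ toℕ (e y′) + n * χ (toℕ r) [mod 2 * n ]) (sym rows) (seconds x y x′ y′ eq)))))
      where
      x≡x′ : x ≡ x′
      x≡x′ = toℕ-injective-mod (+-cancelʳ-mod 0 (bumps (bump-≢ y≢p) (bump-≢ y′≢p)))
      rows : row x y ≡ row x′ y′
      rows = cong (ι m) (cong₂ (λ a b → 2 * toℕ a + b) x≡x′ (trans (bump-≢ y≢p) (sym (bump-≢ y′≢p))))
    by-cases (no y≢p) (yes y′≡p) = contradiction (subst (λ w → lifted (x , y) -Γ (x , y) ≡ lifted (x′ , w) -Γ (x′ , w)) y′≡p eq)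
      (mixed x y x′ y≢p (λ x′≡x₀ → v≢P (cong₂ _,_ x′≡x₀ y′≡p)))
    by-cases (yes y≡p) (no y′≢p) = contradiction (subst (λ w → lifted (x′ , y′) -Γ (x′ , y′) ≡ lifted (x , w) -Γ (x , w)) y≡p (sym eq))
      (mixed x′ y′ x y′≢p (λ x≡x₀ → u≢P (cong₂ _,_ x≡x₀ y≡p)))

  lift : NearOrthomorphism m n (x₀ , p)
  lift = record
    { ψ              = lifted
    ; injective      = lifted-injective
    ; fixes-0        = lifted-fixes-0
    ; fixes-P        = lifted-fixes-P
    ; P≢0            = λ e → p≢0 (cong proj₂ e)
    ; diff-injective = lifted-diff-injective
    ; diff≢t         = lifted-diff≢t
    }

data Parity : ℕ → Set where
  even : ∀ q → Parity (2 * q)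
  odd  : ∀ q → Parity (1 + 2 * q)

parity : ∀ x → Parity x
parity zero = even 0
parity (suc zero) = odd 0
parity (suc (suc x)) with parity x
... | even q = subst Parity (*-suc 2 q) (even (suc q))
... | odd q  = subst Parity (cong suc (*-suc 2 q)) (odd (suc q))

[r+q*2]/2≡q : ∀ r q → r < 2 → (r + q * 2) / 2 ≡ q
[r+q*2]/2≡q r q r<2 = trans (+-distrib-/ r (q * 2) r%2+0<2) (cong₂ _+_ (m<n⇒m/n≡0 r<2) (m*n/n≡m q 2))
  where
  r%2+0<2 : r % 2 + (q * 2) % 2 < 2
  r%2+0<2 = subst (λ z → r % 2 + z < 2) (sym (m*n%n≡0 q 2)) (subst (_< 2) (sym (+-identityʳ (r % 2))) (m%n<n r 2))

[2h+1]/2≡h : ∀ h → (2 * h + 1) / 2 ≡ h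
[2h+1]/2≡h h = trans (cong (_/ 2) (trans (+-comm (2 * h) 1) (cong suc (*-comm 2 h)))) ([r+q*2]/2≡q 1 h (s≤s (s≤s z≤n)))

[1+2h+1]/2≡1+h : ∀ h → (1 + 2 * h + 1) / 2 ≡ suc h
[1+2h+1]/2≡1+h h = trans (cong (_/ 2) (trans (+-comm (1 + 2 * h) 1) (cong (2 +_) (*-comm 2 h)))) ([r+q*2]/2≡q 0 (suc h) (s≤s z≤n))

2*[n+1]/2≡n+1∨n : ∀ n → 2 * ((n + 1) / 2) ≡ n + 1 ⊎ 2 * ((n + 1) / 2) ≡ n
2*[n+1]/2≡n+1∨n n with parity n
... | even h = inj₂ (cong (2 *_) ([2h+1]/2≡h h))
... | odd h  = inj₁ (trans (cong (2 *_) ([1+2h+1]/2≡1+h h)) (trans (*-suc 2 h) (cong suc (+-comm 1 (2 * h)))))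

2j*n≡0-mod2n : ∀ j n → 2 * j * n ≡ 0 [mod 2 * n ]
2j*n≡0-mod2n j n = subst (_≡ 0 [mod 2 * n ]) (regroup j n) (*k≡0-mod j)
  where
  regroup : ∀ j n → j * (2 * n) ≡ 2 * j * n
  regroup = solve-∀

-- fixPt for m = 1 + 2k, with -k written as k + 1.
fixed-point : ∀ k n .{{_ : NonZero n}} → Grp.Γ (1 + 2 * k) n
fixed-point k n = Grp.embed (1 + 2 * k) n (suc k) ((n + 1) / 2 + k * n)

fixPt≡fixed-point : ∀ k n .{{_ : NonZero n}} → Grp.fixPt (1 + 2 * k) n ≡ fixed-point k n
fixPt≡fixed-point k n = cong₂ _,_
  (trans (cong (λ x → Cyclic.neg m (ι m x)) [2k]/2≡k) (neg-ι {x = suc k} {y = k} (mod-trans (mod-reflexive 1+k+k≡m) k≡0-mod)))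
  (cong (λ x → ι (2 * n) ((n + 1) / 2 + x * n)) [2k]/2≡k)
  where
  open Grp (1 + 2 * k) n using (nz2n)
  m : ℕ
  m = 1 + 2 * k
  [2k]/2≡k : 2 * k / 2 ≡ k
  [2k]/2≡k = trans (cong (_/ 2) (*-comm 2 k)) (m*n/n≡m k 2)
  1+k+k≡m : suc k + k ≡ m
  1+k+k≡m = cong suc (cong (k +_) (sym (+-identityʳ k)))

case-k-even : ∀ j n .{{_ : NonZero n}} → NearOrthomorphism (1 + 2 * (2 * j)) n (fixed-point (2 * j) n)
case-k-even j n = Lifting.lift (1 + 2 * (2 * j)) n (2 * j) refl
  (subst (NearOrthomorphism 1 n)
    (embed-cong 1 n (mod-refl {x = 0}) (mod-sym (mod-trans (+-congˡ-mod c (2j*n≡0-mod2n j n)) (mod-reflexive (+-identityʳ c)))))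
    (Reflection.reflection n c (2*[n+1]/2≡n+1∨n n)))
  where
  c : ℕ
  c = (n + 1) / 2

case-n-even : ∀ j h .{{_ : NonZero (2 * h)}} → NearOrthomorphism (1 + 2 * (1 + 2 * j)) (2 * h) (fixed-point (1 + 2 * j) (2 * h))
case-n-even j h = subst (λ c → NearOrthomorphism m n (Grp.embed m n (suc k) (c + k * n))) (sym ([2h+1]/2≡h h))
  (Lifting.lift m n k refl (subst (NearOrthomorphism 1 n) antipode (Negation.negation 1 n (Reflection.reflection n h (inj₂ refl)))))
  where
  k m n : ℕ
  k = 1 + 2 * j
  m = 1 + 2 * k
  n = 2 * h
  antipode : Grp.negΓ 1 n (Grp.embed 1 n 0 h) ≡ Grp.embed 1 n 0 (h + k * n)
  antipode = cong₂ _,_ (Fin1-irrelevant _ _) (neg-ι (begin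
    h + k * n + h         ≡⟨ regroup h j ⟩
    (1 + j) * (2 * n)     ≈⟨ *k≡0-mod (1 + j) ⟩
    0                     ∎))
    where
    open Grp 1 n using (nz2n)
    open mod-Reasoning (2 * n)
    regroup : ∀ h j → h + (1 + 2 * j) * (2 * h) + h ≡ (1 + j) * (2 * (2 * h))
    regroup = solve-∀

case-n≡1-mod-4 : ∀ j i → NearOrthomorphism (1 + 2 * (1 + 2 * j)) (1 + 2 * (2 * i)) (fixed-point (1 + 2 * j) (1 + 2 * (2 * i)))
case-n≡1-mod-4 j i = subst (λ c′ → NearOrthomorphism m n (Grp.embed m n (suc k) (c′ + k * n))) (sym ([1+2h+1]/2≡1+h h))
  (subst (NearOrthomorphism m n) (trans (Swap.swap-embed n m h k c (n + 2) refl refl c-odd c-unit (suc h) (suc k))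
                                        (embed-cong m n (mod-refl {x = suc k}) swapped-point))
    (Swap.swap n m h k c (n + 2) refl refl c-odd c-unit
      (Lifting.lift n m h refl (Reflection.reflection m (suc k) (inj₁ 2[1+k]≡m+1)))))
  where
  k m h n c : ℕ
  k = 1 + 2 * j
  m = 1 + 2 * k
  h = 2 * i
  n = 1 + 2 * h
  c = suc h
  2[1+k]≡m+1 : 2 * suc k ≡ m + 1
  2[1+k]≡m+1 = trans (*-suc 2 k) (cong suc (+-comm 1 (2 * k)))
  c-odd : c ≡ 1 [mod 2 ]
  c-odd = congruent 0 i (trans (+-identityʳ c) (cong suc (*-comm 2 i)))
  c-unit : (n + 2) * c ≡ 1 [mod 2 * n ]
  c-unit = congruent 0 (i + 1) (expand i)
    where
    expand : ∀ i → (1 + 2 * (2 * i) + 2) * suc (2 * i) + 0 * (2 * (1 + 2 * (2 * i))) ≡ 1 + (i + 1) * (2 * (1 + 2 * (2 * i)))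
    expand = solve-∀
  swapped-point : c * (2 * suc h + suc k * n) ≡ c + k * n [mod 2 * n ]
  swapped-point = congruent 0 (2 * i * j + 3 * i + 1) (expand i j)
    where
    expand : ∀ i j → suc (2 * i) * (2 * suc (2 * i) + suc (1 + 2 * j) * (1 + 2 * (2 * i))) + 0 * (2 * (1 + 2 * (2 * i)))
                     ≡ suc (2 * i) + (1 + 2 * j) * (1 + 2 * (2 * i)) + (2 * i * j + 3 * i + 1) * (2 * (1 + 2 * (2 * i)))
    expand = solve-∀

case-n≡3-mod-4 : ∀ j i → NearOrthomorphism (1 + 2 * (1 + 2 * j)) (1 + 2 * (1 + 2 * i)) (fixed-point (1 + 2 * j) (1 + 2 * (1 + 2 * i)))
case-n≡3-mod-4 j i = subst (λ c′ → NearOrthomorphism m n (Grp.embed m n (suc k) (c′ + k * n))) (sym ([1+2h+1]/2≡1+h h))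
  (Lifting.lift m n k refl
    (subst (NearOrthomorphism 1 n) (trans (Swap.swap-embed n 1 h 0 ν (n + 2) refl refl ν-odd ν-unit (suc h) 1)
                                          (embed-cong 1 n (mod-1 1 0) swapped-point))
      (Swap.swap n 1 h 0 ν (n + 2) refl refl ν-odd ν-unit
        (Lifting.lift n 1 h refl (Reflection.reflection 1 1 (inj₁ refl))))))
  where
  k m h n c ν : ℕ
  k = 1 + 2 * j
  m = 1 + 2 * k
  h = 1 + 2 * i
  n = 1 + 2 * h
  c = suc h
  ν = c + n
  ν-odd : ν ≡ 1 [mod 2 ]
  ν-odd = congruent 0 (2 + 3 * i) (expand i)
    where
    expand : ∀ i → suc (1 + 2 * i) + (1 + 2 * (1 + 2 * i)) + 0 * 2 ≡ 1 + (2 + 3 * i) * 2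
    expand = solve-∀
  ν-unit : (n + 2) * ν ≡ 1 [mod 2 * n ]
  ν-unit = congruent 0 (4 + 3 * i) (expand i)
    where
    expand : ∀ i → (1 + 2 * (1 + 2 * i) + 2) * (suc (1 + 2 * i) + (1 + 2 * (1 + 2 * i))) + 0 * (2 * (1 + 2 * (1 + 2 * i)))
                   ≡ 1 + (4 + 3 * i) * (2 * (1 + 2 * (1 + 2 * i)))
    expand = solve-∀
  swapped-point : ν * (2 * suc h + 1 * n) ≡ c + k * n [mod 2 * n ]
  swapped-point = congruent j (c + n) (expand h j)
    where
    expand : ∀ h j → (suc h + (1 + 2 * h)) * (2 * suc h + 1 * (1 + 2 * h)) + j * (2 * (1 + 2 * h))
                     ≡ suc h + (1 + 2 * j) * (1 + 2 * h) + (suc h + (1 + 2 * h)) * (2 * (1 + 2 * h))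
    expand = solve-∀

nearOrthomorphism-at-fixed-point : ∀ k n .{{_ : NonZero n}} → NearOrthomorphism (1 + 2 * k) n (fixed-point k n)
nearOrthomorphism-at-fixed-point k n with parity k
... | even j = case-k-even j n
... | odd j with parity n
...   | even h = case-n-even j h
...   | odd h with parity h
...     | even i = case-n≡1-mod-4 j i
...     | odd i  = case-n≡3-mod-4 j i

theorem2p3 : (m n : ℕ) .{{_ : NonZero m}} .{{_ : NonZero n}} → m % 2 ≡ 1 →
    Σ[ ψ ∈ (Grp.Γ m n ↔ Grp.Γ m n) ]
      (Grp.IsΔPerm m n (Grp.Δ₀ m n) ψ
       × Inverse.to ψ (Grp.zeroΓ m n) ≡ Grp.zeroΓ m n
       × Inverse.to ψ (Grp.fixPt m n) ≡ Grp.fixPt m n)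
theorem2p3 m n m%2≡1 with parity m
... | even q = contradiction (trans (sym (trans (cong (_% 2) (*-comm 2 q)) (m*n%n≡0 q 2))) m%2≡1) 0≢1+n
... | odd k  = nearOrthomorphism⇒ΔPerm m n
                 (subst (NearOrthomorphism m n) (sym (fixPt≡fixed-point k n)) (nearOrthomorphism-at-fixed-point k n))
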